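{- Let $G=\{g_1:=0,g_2,\ldots,g_n\}$ be a finite Abelian group of order $n\ge3$, let $A_{n-1}=\{{\boldsymbol x}\in\mathbb{Z}^n:\sum_{i=1}^n x_i=0\}$ and $$L_G=\Big\{{\boldsymbol x}=(x_1,\ldots,x_n)\in A_{n-1}:\ \sum_{j=2}^n x_j g_j=0\Big\}.$$ Then the stabilizer of $L_G$ in $\operatorname{Aut}(A_{n-1})$, i.e. the group of all $\varphi\in\operatorname{Aut}(A_{n-1})$ with $\varphi(L_G)=L_G$, is isomorphic to $C_2\times(G\rtimes\operatorname{Aut}(G))$.
   Context: $\operatorname{Aut}(A_{n-1})$ is the group of orthogonal transformations of the hyperplane $\{{\boldsymbol x}\in\mathbb{R}^n:\sum x_i=0\}$ mapping $A_{n-1}$ onto itself. $C_2$ is the cyclic group of order 2, $\operatorname{Aut}(G)$ the group automorphism group of $G$, and $G\rtimes\operatorname{Aut}(G)$ the semidirect product with respect to the natural action of $\operatorname{Aut}(G)$ on $G$. -}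

module Defs where

open import Level using (Level; _⊔_)
open import Data.Nat using (ℕ; zero; suc)
open import Data.Integer using (ℤ; +_; -[1+_]; _+_; _*_; 0ℤ; _≟_)
open import Data.Fin using (Fin)
import Data.Fin as Fin
open import Data.Vec using (Vec; []; _∷_; zipWith; lookup)
open import Data.Bool using (Bool; _xor_)
open import Data.Product using (Σ; ∃; _×_; _,_; proj₁; proj₂)
open import Relation.Binary.PropositionalEquality
  using (_≡_; refl; sym; trans; cong; cong₂)
import Axiom.UniquenessOfIdentityProofs as UIPm
open import Algebra.Bundles using (AbelianGroup)
open import Algebra.Bundles.Raw using (RawMagma)
open import Function.Definitions using (Bijective; Injective; Surjective)

sumℤ : ∀ {n} → Vec ℤ n → ℤ
sumℤ []       = 0ℤ
sumℤ (x ∷ xs) = x + sumℤ xs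

⟨_,_⟩ : ∀ {n} → Vec ℤ n → Vec ℤ n → ℤ
⟨ x , y ⟩ = sumℤ (zipWith _*_ x y)

A : ℕ → Set
A n = Σ (Vec ℤ n) (λ x → sumℤ x ≡ 0ℤ)

vec : ∀ {n} → A n → Vec ℤ n
vec = proj₁

vec-inj : ∀ {n} {x y : A n} → vec x ≡ vec y → x ≡ y
vec-inj {x = v , p} {y = .v , q} refl = cong (v ,_) (UIPm.Decidable⇒UIP.≡-irrelevant _≟_ p q)

sum-zipWith-+ : ∀ {n} (x y : Vec ℤ n) → sumℤ (zipWith _+_ x y) ≡ sumℤ x + sumℤ y
sum-zipWith-+ [] [] = refl
sum-zipWith-+ (a ∷ x) (b ∷ y) rewrite sum-zipWith-+ x y = lemma a b (sumℤ x) (sumℤ y)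
  where
  open import Data.Integer.Properties using (+-assoc; +-comm)
  lemma : ∀ a b s t → a + b + (s + t) ≡ a + s + (b + t)
  lemma a b s t = trans (+-assoc a b (s + t))
    (trans (cong (λ w → a + w) (trans (sym (+-assoc b s t))
      (trans (cong (_+ t) (+-comm b s)) (+-assoc s b t))))
      (sym (+-assoc a s (b + t))))

_+A_ : ∀ {n} → A n → A n → A n
(x , p) +A (y , q) = zipWith _+_ x y
  , trans (sum-zipWith-+ x y) (trans (cong₂ _+_ p q) refl)

-- Aut(A_{n-1}): an orthogonal transformation of the hyperplane Σxᵢ=0 mapping
-- A_{n-1} onto itself is the same as (is determined by, and determines) an
-- additive (= ℤ-linear) bijection of A_{n-1} preserving the inner product,
-- since A_{n-1} spans the hyperplane.
record AutA (n : ℕ) : Set where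
  field
    to       : A n → A n
    from     : A n → A n
    to-from  : ∀ x → vec (to (from x)) ≡ vec x
    from-to  : ∀ x → vec (from (to x)) ≡ vec x
    additive : ∀ x y → vec (to (x +A y)) ≡ zipWith _+_ (vec (to x)) (vec (to y))
    isometry : ∀ x y → ⟨ vec (to x) , vec (to y) ⟩ ≡ ⟨ vec x , vec y ⟩

module _ {c ℓ : Level} (G : AbelianGroup c ℓ) where
  open AbelianGroup G using (Carrier; _≈_; _∙_; ε; _⁻¹)
  private module Gr = AbelianGroup G

  natMul : ℕ → Carrier → Carrier
  natMul zero    g = ε
  natMul (suc k) g = g ∙ natMul k g

  intMul : ℤ → Carrier → Carrier
  intMul (+ k)      g = natMul k g
  intMul -[1+ k ]   g = (natMul (suc k) g) ⁻¹

  gsum : ∀ {k} → (Fin k → Carrier) → Carrier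
  gsum {zero}  f = ε
  gsum {suc k} f = f Fin.zero ∙ gsum (λ i → f (Fin.suc i))

  -- membership in L_G, for the enumeration g : Fin (suc m) → G (n = suc m),
  -- g 0 = g₁ = 0:   Σ_{j=2}^{n} x_j g_j = 0
  InL : ∀ {m} → (Fin (suc m) → Carrier) → A (suc m) → Set ℓ
  InL g x = gsum (λ j → intMul (lookup (vec x) (Fin.suc j)) (g (Fin.suc j))) ≈ ε

  record Stab {m : ℕ} (g : Fin (suc m) → Carrier) : Set ℓ where
    field
      aut       : AutA (suc m)
    open AutA aut public
    field
      maps-into : ∀ x → InL g x → InL g (to x)
      maps-onto : ∀ x → InL g x → Σ (A (suc m)) (λ y → InL g y × vec (to y) ≡ vec x)

  module _ {m : ℕ} (g : Fin (suc m) → Carrier) where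
    private
      cong-to : (φ : AutA (suc m)) → ∀ {x y} → vec x ≡ vec y
              → vec (AutA.to φ x) ≡ vec (AutA.to φ y)
      cong-to φ e = cong (λ z → vec (AutA.to φ z)) (vec-inj e)

    compStab : Stab g → Stab g → Stab g
    compStab φ ψ = record
      { aut = record
        { to       = λ x → Φ.to (Ψ.to x)
        ; from     = λ x → Ψ.from (Φ.from x)
        ; to-from  = λ x → trans (cong-to Φ.aut (Ψ.to-from (Φ.from x))) (Φ.to-from x)
        ; from-to  = λ x → trans (cong-to (inv Ψ.aut) (Φ.from-to (Ψ.to x))) (Ψ.from-to x)
        ; additive = λ x y → trans (cong-to Φ.aut {y = Ψ.to x +A Ψ.to y} (Ψ.additive x y))
                                   (Φ.additive (Ψ.to x) (Ψ.to y))
        ; isometry = λ x y → trans (Φ.isometry (Ψ.to x) (Ψ.to y)) (Ψ.isometry x y)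
        }
      ; maps-into = λ x p → Φ.maps-into (Ψ.to x) (Ψ.maps-into x p)
      ; maps-onto = λ x p →
          let (y , py , ey) = Φ.maps-onto x p
              (z , pz , ez) = Ψ.maps-onto y py
          in z , pz , trans (cong-to Φ.aut ez) ey
      }
      where
      module Φ = Stab φ
      module Ψ = Stab ψ
      inv : AutA (suc m) → AutA (suc m)
      inv φ′ = record
        { to = AutA.from φ′ ; from = AutA.to φ′
        ; to-from = AutA.from-to φ′ ; from-to = AutA.to-from φ′
        ; additive = λ x y → additive-from x y
        ; isometry = λ x y → iso-from x y }
        where
        module F = AutA φ′
        cf : ∀ {x y} → vec x ≡ vec y → vec (F.to x) ≡ vec (F.to y)
        cf e = cong (λ z → vec (F.to z)) (vec-inj e)
        inj : ∀ {u v} → vec (F.to u) ≡ vec (F.to v) → vec u ≡ vec v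
        inj {u} {v} e = trans (sym (F.from-to u))
          (trans (cong (λ z → vec (F.from z)) (vec-inj e)) (F.from-to v))
        additive-from : ∀ x y → vec (F.from (x +A y)) ≡ zipWith _+_ (vec (F.from x)) (vec (F.from y))
        additive-from x y = inj {F.from (x +A y)} {F.from x +A F.from y}
          (trans (F.to-from (x +A y))
            (sym (trans (F.additive (F.from x) (F.from y))
              (cong₂ (zipWith _+_) (F.to-from x) (F.to-from y)))))
        iso-from : ∀ x y → ⟨ vec (F.from x) , vec (F.from y) ⟩ ≡ ⟨ vec x , vec y ⟩
        iso-from x y = trans (sym (F.isometry (F.from x) (F.from y)))
          (cong₂ ⟨_,_⟩ (F.to-from x) (F.to-from y))

    StabMagma : RawMagma ℓ Level.zero
    StabMagma = record
      { Carrier = Stab g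
      ; _≈_     = λ φ ψ → ∀ x → vec (Stab.to φ x) ≡ vec (Stab.to ψ x)
      ; _∙_     = compStab
      }

  record AutG : Set (c ⊔ ℓ) where
    field
      f         : Carrier → Carrier
      f-cong    : ∀ {x y} → x ≈ y → f x ≈ f y
      f-homo    : ∀ x y → f (x ∙ y) ≈ f x ∙ f y
      bijective : Bijective _≈_ _≈_ f

  compAut : AutG → AutG → AutG
  compAut φ ψ = record
    { f = λ x → Φ.f (Ψ.f x)
    ; f-cong = λ e → Φ.f-cong (Ψ.f-cong e)
    ; f-homo = λ x y → Gr.trans (Φ.f-cong (Ψ.f-homo x y)) (Φ.f-homo (Ψ.f x) (Ψ.f y))
    ; bijective = (λ e → proj₁ Ψ.bijective (proj₁ Φ.bijective e))
                , λ y → let (x₁ , h₁) = proj₂ Φ.bijective y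
                            (x₂ , h₂) = proj₂ Ψ.bijective x₁
                        in x₂ , λ z≈ → h₁ (h₂ z≈)
    }
    where
    module Φ = AutG φ
    module Ψ = AutG ψ

  SD : Set (c ⊔ ℓ)
  SD = Carrier × AutG

  _≈SD_ : SD → SD → Set (c ⊔ ℓ)
  (g , φ) ≈SD (h , ψ) = g ≈ h × (∀ x → AutG.f φ x ≈ AutG.f ψ x)

  _·SD_ : SD → SD → SD
  (g , φ) ·SD (h , ψ) = g ∙ AutG.f φ h , compAut φ ψ

  C2×SD : RawMagma (c ⊔ ℓ) (c ⊔ ℓ)
  C2×SD = record
    { Carrier = Bool × SD
    ; _≈_     = λ { (a , s) (b , t) → a ≡ b × s ≈SD t }
    ; _∙_     = λ { (a , s) (b , t) → (a xor b) , (s ·SD t) }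
    }

{-# OPTIONS --safe #-}
module Submission where

-- An automorphism of A_{n-1} maps roots e_a - e_b to roots (the vectors of norm 2), and the images of
-- the roots e_0 - e_k, having pairwise inner product 1, share a common endpoint.  For n ≥ 3 this forces
-- every automorphism to be x ↦ ±(x permuted by σ), with the sign and σ unique.  Identifying the coordinates
-- with the elements g_i of G, L_G is the kernel of the weight x ↦ Σ x_i g_i, and σ preserves it exactly when
-- the induced bijection of G is affine, y ↦ h + α(y) with α ∈ Aut(G): testing on the element
-- (e_{y+z} - e_y) + (e_0 - e_z) of L_G shows α is additive, and conversely an affine relabelling changes the
-- weight of a vector of coordinate sum 0 only by the automorphism α.  The isomorphism is φ ↦ (±, h, α).

open import Defs
open import Data.Bool using (Bool; true; false; if_then_else_; _xor_)
open import Data.Fin using (Fin; zero; suc; _≟_; punchIn; punchOut)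
import Data.Fin.Properties as Finₚ
open import Data.Fin.Permutation as Perm using (Permutation′; _⟨$⟩ʳ_; _⟨$⟩ˡ_; _∘ₚ_)
open import Data.Integer.Base as ℤ using (ℤ; +_; -[1+_]; 0ℤ; 1ℤ; -1ℤ; ∣_∣; _⊖_)
import Data.Integer.Properties as ℤₚ
open import Data.Integer.Tactic.RingSolver using (solve-∀)
open import Data.Nat as ℕ using (ℕ; zero; suc; _≤_; z≤n; s≤s)
import Data.Nat.Properties as ℕₚ
open import Data.Product using (Σ; ∃; ∃₂; _×_; _,_; proj₁; proj₂)
open import Data.Sum as Sum using (_⊎_; inj₁; inj₂)
open import Data.Vec using (Vec; []; _∷_; lookup; tabulate; replicate; zipWith)
import Data.Vec.Properties as Vecₚ
open import Function.Definitions using (Bijective; Injective; Surjective)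
open import Relation.Binary.PropositionalEquality as ≡ using (_≡_; _≢_)
open import Relation.Nullary using (does; yes; no; contradiction)
open import Algebra.Bundles using (AbelianGroup)
open import Algebra.Bundles.Raw using (RawMagma)
open import Algebra.Morphism.Structures using (module MagmaMorphisms)

private
  variable
    n : ℕ

module Roots where
  open import Data.Integer.Base using (_+_; _*_; _-_; -_)
  open import Relation.Binary.PropositionalEquality
  open import Algebra.Properties.Semiring.Sum ℤₚ.+-*-semiring
    using (sum; sum-cong-≗; ∑-distrib-+; *-distribˡ-sum; sum-replicate-zero)

  sgn : Bool → ℤ
  sgn false = 1ℤ
  sgn true  = -1ℤ

  sgn*sgn≡1 : ∀ s → sgn s * sgn s ≡ 1ℤ
  sgn*sgn≡1 false = refl
  sgn*sgn≡1 true  = refl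

  sgn*[sgn*z]≡z : ∀ s z → sgn s * (sgn s * z) ≡ z
  sgn*[sgn*z]≡z s z = trans (sym (ℤₚ.*-assoc (sgn s) (sgn s) z)) (trans (cong (_* z) (sgn*sgn≡1 s)) (ℤₚ.*-identityˡ z))

  sgn*u*[sgn*v]≡u*v : ∀ s u v → sgn s * u * (sgn s * v) ≡ u * v
  sgn*u*[sgn*v]≡u*v s u v = trans (rearrange (sgn s) u v) (trans (cong (_* (u * v)) (sgn*sgn≡1 s)) (ℤₚ.*-identityˡ (u * v)))
    where
    rearrange : ∀ e u v → e * u * (e * v) ≡ e * e * (u * v)
    rearrange = solve-∀

  sgn-xor : ∀ s t → sgn (s xor t) ≡ sgn s * sgn t
  sgn-xor false false = refl
  sgn-xor false true  = refl
  sgn-xor true  false = refl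
  sgn-xor true  true  = refl

  sgn-injective : ∀ {s t} → sgn s ≡ sgn t → s ≡ t
  sgn-injective {false} {false} _ = refl
  sgn-injective {true}  {true}  _ = refl

  sgn≢0 : ∀ s → sgn s ≢ 0ℤ
  sgn≢0 false ()
  sgn≢0 true  ()

  δ : Fin n → Fin n → ℤ
  δ t a = if does (t ≟ a) then 1ℤ else 0ℤ

  δ-view : (t a : Fin n) → (t ≡ a × δ t a ≡ 1ℤ) ⊎ (t ≢ a × δ t a ≡ 0ℤ)
  δ-view t a with t ≟ a
  ... | yes t≡a = inj₁ (t≡a , refl)
  ... | no  t≢a = inj₂ (t≢a , refl)

  δ-refl : (a : Fin n) → δ a a ≡ 1ℤ
  δ-refl a with δ-view a a
  ... | inj₁ (_ , δ≡1) = δ≡1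
  ... | inj₂ (a≢a , _) = contradiction refl a≢a

  δ-≢ : {t a : Fin n} → t ≢ a → δ t a ≡ 0ℤ
  δ-≢ {t = t} {a} t≢a with δ-view t a
  ... | inj₁ (t≡a , _) = contradiction t≡a t≢a
  ... | inj₂ (_ , δ≡0) = δ≡0

  root : Fin n → Fin n → Vec ℤ n
  root a b = tabulate (λ t → δ t a - δ t b)

  lookup-root : (a b t : Fin n) → lookup (root a b) t ≡ δ t a - δ t b
  lookup-root a b = Vecₚ.lookup∘tabulate _

  lookup-ext : {u v : Vec ℤ n} → (∀ t → lookup u t ≡ lookup v t) → u ≡ v
  lookup-ext {u = u} {v} u≗v = begin
    u                   ≡⟨ Vecₚ.tabulate∘lookup u ⟨
    tabulate (lookup u) ≡⟨ Vecₚ.tabulate-cong u≗v ⟩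
    tabulate (lookup v) ≡⟨ Vecₚ.tabulate∘lookup v ⟩
    v                   ∎
    where open ≡-Reasoning

  sumℤ≡sum : (v : Vec ℤ n) → sumℤ v ≡ sum (lookup v)
  sumℤ≡sum []      = refl
  sumℤ≡sum (x ∷ v) = cong (_+_ x) (sumℤ≡sum v)

  sumℤ-tabulate : (f : Fin n → ℤ) → sumℤ (tabulate f) ≡ sum f
  sumℤ-tabulate f = trans (sumℤ≡sum (tabulate f)) (sum-cong-≗ (Vecₚ.lookup∘tabulate f))

  ⟨⟩≡sum : (x y : Vec ℤ n) → ⟨ x , y ⟩ ≡ sum (λ i → lookup x i * lookup y i)
  ⟨⟩≡sum []      []      = refl
  ⟨⟩≡sum (a ∷ x) (b ∷ y) = cong (_+_ (a * b)) (⟨⟩≡sum x y)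

  sum-δ : (f : Fin n → ℤ) (a : Fin n) → sum (λ i → f i * δ i a) ≡ f a
  sum-δ {suc n} f zero = trans
    (cong₂ _+_ (ℤₚ.*-identityʳ (f zero))
               (trans (sum-cong-≗ (λ i → ℤₚ.*-zeroʳ (f (suc i)))) (sum-replicate-zero n)))
    (ℤₚ.+-identityʳ (f zero))
  sum-δ {suc n} f (suc a) = trans
    (cong₂ _+_ (ℤₚ.*-zeroʳ (f zero)) (sum-δ (λ i → f (suc i)) a))
    (ℤₚ.+-identityˡ (f (suc a)))

  ⟨x,root⟩ : (x : Vec ℤ n) (a b : Fin n) → ⟨ x , root a b ⟩ ≡ lookup x a - lookup x b
  ⟨x,root⟩ {n} x a b = begin
    ⟨ x , root a b ⟩                                          ≡⟨ ⟨⟩≡sum x (root a b) ⟩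
    sum (λ i → x′ i * lookup (root a b) i)                    ≡⟨ sum-cong-≗ split ⟩
    sum (λ i → x′ i * δ i a + -1ℤ * (x′ i * δ i b))
      ≡⟨ ∑-distrib-+ (λ i → x′ i * δ i a) (λ i → -1ℤ * (x′ i * δ i b)) ⟩
    sum (λ i → x′ i * δ i a) + sum (λ i → -1ℤ * (x′ i * δ i b))
      ≡⟨ cong (_+_ (sum (λ i → x′ i * δ i a))) (*-distribˡ-sum -1ℤ (λ i → x′ i * δ i b)) ⟨
    sum (λ i → x′ i * δ i a) + -1ℤ * sum (λ i → x′ i * δ i b) ≡⟨ cong₂ (λ u v → u + -1ℤ * v) (sum-δ x′ a) (sum-δ x′ b) ⟩
    x′ a + -1ℤ * x′ b                                         ≡⟨ cong (_+_ (x′ a)) (ℤₚ.-1*i≡-i (x′ b)) ⟩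
    x′ a - x′ b                                               ∎
    where
    open ≡-Reasoning
    x′ : Fin n → ℤ
    x′ = lookup x
    distrib : ∀ u p q → u * (p - q) ≡ u * p + -1ℤ * (u * q)
    distrib = solve-∀
    split : ∀ i → x′ i * lookup (root a b) i ≡ x′ i * δ i a + -1ℤ * (x′ i * δ i b)
    split i = trans (cong (x′ i *_) (lookup-root a b i)) (distrib (x′ i) (δ i a) (δ i b))

  sumℤ≡⟨1,v⟩ : (v : Vec ℤ n) → sumℤ v ≡ ⟨ replicate n 1ℤ , v ⟩
  sumℤ≡⟨1,v⟩ []      = refl
  sumℤ≡⟨1,v⟩ (x ∷ v) = cong₂ _+_ (sym (ℤₚ.*-identityˡ x)) (sumℤ≡⟨1,v⟩ v)

  -- Opaque: unfolding this proof during unification further down exhausts memory.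
  opaque
    sumℤ-root : (a b : Fin n) → sumℤ (root a b) ≡ 0ℤ
    sumℤ-root {n} a b = begin
      sumℤ (root a b)                  ≡⟨ sumℤ≡⟨1,v⟩ (root a b) ⟩
      ⟨ replicate n 1ℤ , root a b ⟩    ≡⟨ ⟨x,root⟩ (replicate n 1ℤ) a b ⟩
      lookup (replicate n 1ℤ) a - lookup (replicate n 1ℤ) b
        ≡⟨ cong₂ _-_ (Vecₚ.lookup-replicate a 1ℤ) (Vecₚ.lookup-replicate b 1ℤ) ⟩
      1ℤ - 1ℤ                          ∎
      where open ≡-Reasoning

  rootA : Fin n → Fin n → A n
  rootA a b = root a b , sumℤ-root a b

  ⟨root,root⟩ : (a b c d : Fin n) → ⟨ root a b , root c d ⟩ ≡ (δ c a - δ c b) - (δ d a - δ d b)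
  ⟨root,root⟩ a b c d = trans (⟨x,root⟩ (root a b) c d) (cong₂ _-_ (lookup-root a b c) (lookup-root a b d))

  ‖_‖² : Vec ℤ n → ℕ
  ‖ []    ‖² = 0
  ‖ x ∷ v ‖² = ∣ x ∣ ℕ.* ∣ x ∣ ℕ.+ ‖ v ‖²

  ⟨v,v⟩≡‖v‖² : (v : Vec ℤ n) → ⟨ v , v ⟩ ≡ + ‖ v ‖²
  ⟨v,v⟩≡‖v‖² []      = refl
  ⟨v,v⟩≡‖v‖² (x ∷ v) = cong₂ _+_ (x*x≡∣x∣² x) (⟨v,v⟩≡‖v‖² v)
    where
    x*x≡∣x∣² : ∀ x → x * x ≡ + (∣ x ∣ ℕ.* ∣ x ∣)
    x*x≡∣x∣² (+ zero)  = refl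
    x*x≡∣x∣² (+ suc _) = refl
    x*x≡∣x∣² -[1+ _ ]  = refl

  4≤‖x∷v‖² : ∀ x (v : Vec ℤ n) → 2 ≤ ∣ x ∣ → 4 ≤ ‖ x ∷ v ‖²
  4≤‖x∷v‖² x v 2≤∣x∣ = ℕₚ.≤-trans (ℕₚ.*-mono-≤ 2≤∣x∣ 2≤∣x∣) (ℕₚ.m≤m+n (∣ x ∣ ℕ.* ∣ x ∣) ‖ v ‖²)

  ‖v‖²≡0⇒v≡0 : (v : Vec ℤ n) → ‖ v ‖² ≡ 0 → v ≡ tabulate (λ _ → 0ℤ)
  ‖v‖²≡0⇒v≡0 []              _  = refl
  ‖v‖²≡0⇒v≡0 (+ zero ∷ v)    ‖v‖²≡0 = cong (0ℤ ∷_) (‖v‖²≡0⇒v≡0 v ‖v‖²≡0)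
  ‖v‖²≡0⇒v≡0 (+ suc _ ∷ _)   ()
  ‖v‖²≡0⇒v≡0 (-[1+ _ ] ∷ _)  ()

  ±e : Bool → Fin n → Vec ℤ n
  ±e s c = tabulate (λ t → sgn s * δ t c)

  sumℤ-±e : ∀ s (c : Fin n) → sumℤ (±e s c) ≡ sgn s
  sumℤ-±e s c = trans (sumℤ-tabulate (λ t → sgn s * δ t c)) (sum-δ (λ _ → sgn s) c)

  ‖v‖²≡1⇒±e : (v : Vec ℤ n) → ‖ v ‖² ≡ 1 → ∃₂ λ s c → v ≡ ±e s c
  ‖v‖²≡1⇒±e (+ zero ∷ v) ‖v‖²≡1 with ‖v‖²≡1⇒±e v ‖v‖²≡1
  ... | s , c , v≡±e = s , suc c , cong₂ _∷_ (sym (ℤₚ.*-zeroʳ (sgn s))) v≡±e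
  ‖v‖²≡1⇒±e (+ 1 ∷ v) ‖v‖²≡1 =
    false , zero , cong (1ℤ ∷_) (‖v‖²≡0⇒v≡0 v (ℕₚ.suc-injective ‖v‖²≡1))
  ‖v‖²≡1⇒±e (-[1+ 0 ] ∷ v) ‖v‖²≡1 =
    true , zero , cong (-1ℤ ∷_) (‖v‖²≡0⇒v≡0 v (ℕₚ.suc-injective ‖v‖²≡1))
  ‖v‖²≡1⇒±e (+ suc (suc k) ∷ v) ‖v‖²≡1 =
    contradiction (subst (4 ≤_) ‖v‖²≡1 (4≤‖x∷v‖² (+ suc (suc k)) v (s≤s (s≤s z≤n)))) λ { (s≤s ()) }
  ‖v‖²≡1⇒±e (-[1+ suc k ] ∷ v) ‖v‖²≡1 =
    contradiction (subst (4 ≤_) ‖v‖²≡1 (4≤‖x∷v‖² -[1+ suc k ] v (s≤s (s≤s z≤n)))) λ { (s≤s ()) }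

  ‖v‖²≡2⇒root : (v : Vec ℤ n) → sumℤ v ≡ 0ℤ → ‖ v ‖² ≡ 2 → ∃₂ λ a b → a ≢ b × v ≡ root a b
  ‖v‖²≡2⇒root (+ zero ∷ v) Σv≡0 ‖v‖²≡2 with ‖v‖²≡2⇒root v (trans (sym (ℤₚ.+-identityˡ _)) Σv≡0) ‖v‖²≡2
  ... | a , b , a≢b , v≡root = suc a , suc b , (λ sa≡sb → a≢b (Finₚ.suc-injective sa≡sb)) , cong (0ℤ ∷_) v≡root
  ‖v‖²≡2⇒root (+ 1 ∷ v) Σv≡0 ‖v‖²≡2 with ‖v‖²≡1⇒±e v (ℕₚ.suc-injective ‖v‖²≡2)
  ... | false , c , refl = contradiction (trans (cong (_+_ 1ℤ) (sym (sumℤ-±e false c))) Σv≡0) λ ()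
  ... | true  , c , refl = zero , suc c , (λ ()) ,
    cong (1ℤ ∷_) (Vecₚ.tabulate-cong λ t → trans (ℤₚ.-1*i≡-i (δ t c)) (sym (ℤₚ.+-identityˡ (- δ t c))))
  ‖v‖²≡2⇒root (-[1+ 0 ] ∷ v) Σv≡0 ‖v‖²≡2 with ‖v‖²≡1⇒±e v (ℕₚ.suc-injective ‖v‖²≡2)
  ... | true  , c , refl = contradiction (trans (cong (_+_ -1ℤ) (sym (sumℤ-±e true c))) Σv≡0) λ ()
  ... | false , c , refl = suc c , zero , (λ ()) ,
    cong (-1ℤ ∷_) (Vecₚ.tabulate-cong λ t → trans (ℤₚ.*-identityˡ (δ t c)) (sym (ℤₚ.+-identityʳ (δ t c))))
  ‖v‖²≡2⇒root (+ suc (suc k) ∷ v) _ ‖v‖²≡2 =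
    contradiction (subst (4 ≤_) ‖v‖²≡2 (4≤‖x∷v‖² (+ suc (suc k)) v (s≤s (s≤s z≤n)))) λ { (s≤s (s≤s ())) }
  ‖v‖²≡2⇒root (-[1+ suc k ] ∷ v) _ ‖v‖²≡2 =
    contradiction (subst (4 ≤_) ‖v‖²≡2 (4≤‖x∷v‖² -[1+ suc k ] v (s≤s (s≤s z≤n)))) λ { (s≤s (s≤s ())) }

  -- ⟨e_a - e_b , e_c - e_d⟩ = [c = a] - [c = b] - [d = a] + [d = b] is 1 only if exactly c = a or exactly d = b.
  root-overlap : {a b c d : Fin n} → a ≢ b → c ≢ d → ⟨ root a b , root c d ⟩ ≡ 1ℤ →
                 (a ≡ c × b ≢ d) ⊎ (b ≡ d × a ≢ c)
  root-overlap {a = a} {b} {c} {d} a≢b c≢d ⟨⟩≡1 =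
    go (δ-view c a) (δ-view c b) (δ-view d a) (δ-view d b) (trans (sym (⟨root,root⟩ a b c d)) ⟨⟩≡1)
    where
    values : ∀ {u v w z} → δ c a ≡ u → δ c b ≡ v → δ d a ≡ w → δ d b ≡ z →
             (δ c a - δ c b) - (δ d a - δ d b) ≡ 1ℤ → (u - v) - (w - z) ≡ 1ℤ
    values refl refl refl refl h = h
    go : (c ≡ a × δ c a ≡ 1ℤ) ⊎ (c ≢ a × δ c a ≡ 0ℤ) → (c ≡ b × δ c b ≡ 1ℤ) ⊎ (c ≢ b × δ c b ≡ 0ℤ) →
         (d ≡ a × δ d a ≡ 1ℤ) ⊎ (d ≢ a × δ d a ≡ 0ℤ) → (d ≡ b × δ d b ≡ 1ℤ) ⊎ (d ≢ b × δ d b ≡ 0ℤ) →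
         (δ c a - δ c b) - (δ d a - δ d b) ≡ 1ℤ → (a ≡ c × b ≢ d) ⊎ (b ≡ d × a ≢ c)
    go (inj₁ (c≡a , _)) (inj₁ (c≡b , _)) _ _ _ = contradiction (trans (sym c≡a) c≡b) a≢b
    go _ _ (inj₁ (d≡a , _)) (inj₁ (d≡b , _)) _ = contradiction (trans (sym d≡a) d≡b) a≢b
    go (inj₁ (c≡a , _)) _ (inj₁ (d≡a , _)) _ _ = contradiction (trans c≡a (sym d≡a)) c≢d
    go _ (inj₁ (c≡b , _)) _ (inj₁ (d≡b , _)) _ = contradiction (trans c≡b (sym d≡b)) c≢d
    go (inj₁ (c≡a , _)) (inj₂ _) (inj₂ _) (inj₂ (d≢b , _)) _ = inj₁ (sym c≡a , λ b≡d → d≢b (sym b≡d))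
    go (inj₂ (c≢a , _)) (inj₂ _) (inj₂ _) (inj₁ (d≡b , _)) _ = inj₂ (sym d≡b , λ a≡c → c≢a (sym a≡c))
    go (inj₂ (_ , e₁)) (inj₂ (_ , e₂)) (inj₂ (_ , e₃)) (inj₂ (_ , e₄)) h = contradiction (values e₁ e₂ e₃ e₄ h) λ ()
    go (inj₂ (_ , e₁)) (inj₁ (_ , e₂)) (inj₂ (_ , e₃)) (inj₂ (_ , e₄)) h = contradiction (values e₁ e₂ e₃ e₄ h) λ ()
    go (inj₂ (_ , e₁)) (inj₂ (_ , e₂)) (inj₁ (_ , e₃)) (inj₂ (_ , e₄)) h = contradiction (values e₁ e₂ e₃ e₄ h) λ ()
    go (inj₁ (_ , e₁)) (inj₂ (_ , e₂)) (inj₂ (_ , e₃)) (inj₁ (_ , e₄)) h = contradiction (values e₁ e₂ e₃ e₄ h) λ ()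
    go (inj₂ (_ , e₁)) (inj₁ (_ , e₂)) (inj₁ (_ , e₃)) (inj₂ (_ , e₄)) h = contradiction (values e₁ e₂ e₃ e₄ h) λ ()

  ⟨root,root⟩≡2 : {a b : Fin n} → a ≢ b → ⟨ root a b , root a b ⟩ ≡ + 2
  ⟨root,root⟩≡2 {a = a} {b} a≢b
    rewrite ⟨root,root⟩ a b a b | δ-refl a | δ-refl b | δ-≢ a≢b | δ-≢ (λ b≡a → a≢b (sym b≡a)) = refl

  ⟨root0,root0⟩≡1 : {k l : Fin n} → k ≢ l → ⟨ root zero (suc k) , root zero (suc l) ⟩ ≡ 1ℤ
  ⟨root0,root0⟩≡1 {k = k} {l} k≢l
    rewrite ⟨root,root⟩ {suc _} zero (suc k) zero (suc l) | δ-≢ (λ l≡k → k≢l (sym l≡k)) = refl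

  root± : Bool → Fin n → Fin n → Vec ℤ n
  root± false a b = root a b
  root± true  a b = root b a

  ⟨x,root±⟩ : (x : Vec ℤ n) (s : Bool) (a b : Fin n) → ⟨ x , root± s a b ⟩ ≡ sgn s * (lookup x a - lookup x b)
  ⟨x,root±⟩ x false a b = trans (⟨x,root⟩ x a b) (sym (ℤₚ.*-identityˡ _))
  ⟨x,root±⟩ x true  a b = trans (⟨x,root⟩ x b a) (negate (lookup x b) (lookup x a))
    where
    negate : ∀ u v → u - v ≡ -1ℤ * (v - u)
    negate = solve-∀

open Roots

module SignedPermutations where
  open import Data.Integer.Base using (_+_; _*_; _-_)
  open import Relation.Binary.PropositionalEquality
  open import Algebra.Properties.Semiring.Sum ℤₚ.+-*-semiring
    using (sum; sum-cong-≗; sum-permute; ∑-distrib-+; *-distribˡ-sum)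

  -- A missed value j could be punched out, giving an injection Fin (suc n) → Fin n.
  injective⇒surjective : (f : Fin n → Fin n) → Injective _≡_ _≡_ f → ∀ j → ∃ λ i → f i ≡ j
  injective⇒surjective {suc n} f f-inj j with Finₚ.any? (λ i → f i ≟ j)
  ... | yes hit = hit
  ... | no  miss = contradiction (Finₚ.injective⇒≤ f′-inj) ℕₚ.1+n≰n
    where
    f≢j : ∀ i → j ≢ f i
    f≢j i j≡fi = miss (i , sym j≡fi)
    f′ : Fin (suc n) → Fin n
    f′ i = punchOut (f≢j i)
    f′-inj : Injective _≡_ _≡_ f′
    f′-inj f′i≡f′k = f-inj (Finₚ.punchOut-injective (f≢j _) (f≢j _) f′i≡f′k)

  injective⇒permutation : (f : Fin n → Fin n) → Injective _≡_ _≡_ f → Permutation′ n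
  injective⇒permutation {n} f f-inj = Perm.permutation f f⁻¹ (λ j → proj₂ (surj j)) (λ i → f-inj (proj₂ (surj (f i))))
    where
    surj : ∀ j → ∃ λ i → f i ≡ j
    surj = injective⇒surjective f f-inj
    f⁻¹ : Fin n → Fin n
    f⁻¹ j = proj₁ (surj j)

  record SignedPermutation {n : ℕ} (T : A n → A n) : Set where
    field
      sign        : Bool
      perm        : Permutation′ n
      lookup-perm : ∀ x i → lookup (vec (T x)) (perm ⟨$⟩ʳ i) ≡ sgn sign * lookup (vec x) i

    lookup-T : ∀ x t → lookup (vec (T x)) t ≡ sgn sign * lookup (vec x) (perm ⟨$⟩ˡ t)
    lookup-T x t = trans (cong (lookup (vec (T x))) (sym (Perm.inverseʳ perm))) (lookup-perm x (perm ⟨$⟩ˡ t))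

  open SignedPermutation

  SignedPermutation-∘ : {T U : A n → A n} → SignedPermutation T → SignedPermutation U →
                        SignedPermutation (λ x → T (U x))
  SignedPermutation-∘ {T = T} {U} R Q = record
    { sign        = sign R xor sign Q
    ; perm        = perm Q ∘ₚ perm R
    ; lookup-perm = λ x i → begin
        lookup (vec (T (U x))) (perm R ⟨$⟩ʳ (perm Q ⟨$⟩ʳ i)) ≡⟨ lookup-perm R (U x) (perm Q ⟨$⟩ʳ i) ⟩
        sgn (sign R) * lookup (vec (U x)) (perm Q ⟨$⟩ʳ i)     ≡⟨ cong (sgn (sign R) *_) (lookup-perm Q x i) ⟩
        sgn (sign R) * (sgn (sign Q) * lookup (vec x) i)     ≡⟨ ℤₚ.*-assoc (sgn (sign R)) _ _ ⟨
        sgn (sign R) * sgn (sign Q) * lookup (vec x) i       ≡⟨ cong (_* lookup (vec x) i) (sgn-xor (sign R) (sign Q)) ⟨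
        sgn (sign R xor sign Q) * lookup (vec x) i           ∎
    }
    where open ≡-Reasoning

  SignedPermutation-ext : {T T′ : A n → A n} (R : SignedPermutation T) (R′ : SignedPermutation T′) →
                          sign R ≡ sign R′ → perm R Perm.≈ perm R′ → ∀ x → vec (T x) ≡ vec (T′ x)
  SignedPermutation-ext {n} {T} {T′} R R′ s≡s′ π≈π′ x = lookup-ext λ t → begin
    lookup (vec (T x)) t                    ≡⟨ cong (lookup (vec (T x))) (Perm.inverseʳ (perm R)) ⟨
    lookup (vec (T x)) (perm R ⟨$⟩ʳ i t)    ≡⟨ lookup-perm R x (i t) ⟩
    sgn (sign R) * lookup (vec x) (i t)     ≡⟨ cong (λ s → sgn s * lookup (vec x) (i t)) s≡s′ ⟩
    sgn (sign R′) * lookup (vec x) (i t)    ≡⟨ lookup-perm R′ x (i t) ⟨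
    lookup (vec (T′ x)) (perm R′ ⟨$⟩ʳ i t)
      ≡⟨ cong (lookup (vec (T′ x))) (trans (sym (π≈π′ (i t))) (Perm.inverseʳ (perm R))) ⟩
    lookup (vec (T′ x)) t                   ∎
    where
    open ≡-Reasoning
    i : Fin n → Fin n
    i t = perm R ⟨$⟩ˡ t

  SignedPermutation-unique : ∀ {p} {T₁ T₂ : A (suc (suc (suc p))) → A (suc (suc (suc p)))} →
                             (∀ x → vec (T₁ x) ≡ vec (T₂ x)) →
                             (R₁ : SignedPermutation T₁) (R₂ : SignedPermutation T₂) →
                             sign R₁ ≡ sign R₂ × perm R₁ Perm.≈ perm R₂
  SignedPermutation-unique {p} {T₁} {T₂} T₁≗T₂ R₁ R₂ = proj₂ (fixed zero) , perm≈
    where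
    s₁ s₂ : ℤ
    s₁ = sgn (sign R₁)
    s₂ = sgn (sign R₂)
    t : Fin (suc (suc (suc p))) → Fin (suc (suc (suc p)))
    t i = perm R₁ ⟨$⟩ˡ (perm R₂ ⟨$⟩ʳ i)

    s₂≡s₁*δ : ∀ i j → j ≢ i → s₂ ≡ s₁ * (δ (t i) i - δ (t i) j)
    s₂≡s₁*δ i j j≢i = begin
      s₂                                   ≡⟨ ℤₚ.*-identityʳ s₂ ⟨
      s₂ * 1ℤ                              ≡⟨ cong (s₂ *_) (cong₂ _-_ (δ-refl i) (δ-≢ (λ i≡j → j≢i (sym i≡j)))) ⟨
      s₂ * (δ i i - δ i j)                 ≡⟨ cong (s₂ *_) (lookup-root i j i) ⟨
      s₂ * lookup (root i j) i             ≡⟨ lookup-perm R₂ (rootA i j) i ⟨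
      lookup (vec (T₂ (rootA i j))) (perm R₂ ⟨$⟩ʳ i) ≡⟨ cong (λ v → lookup v (perm R₂ ⟨$⟩ʳ i)) (T₁≗T₂ (rootA i j)) ⟨
      lookup (vec (T₁ (rootA i j))) (perm R₂ ⟨$⟩ʳ i) ≡⟨ lookup-T R₁ (rootA i j) (perm R₂ ⟨$⟩ʳ i) ⟩
      s₁ * lookup (root i j) (t i)         ≡⟨ cong (s₁ *_) (lookup-root i j (t i)) ⟩
      s₁ * (δ (t i) i - δ (t i) j)         ∎
      where open ≡-Reasoning

    fixed-or-swapped : ∀ i j → j ≢ i → (t i ≡ i × sign R₁ ≡ sign R₂) ⊎ t i ≡ j
    fixed-or-swapped i j j≢i with δ-view (t i) i | δ-view (t i) j
    ... | inj₁ (ti≡i , _) | inj₁ (ti≡j , _) = contradiction (trans (sym ti≡j) ti≡i) j≢i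
    ... | inj₂ _          | inj₁ (ti≡j , _) = inj₂ ti≡j
    ... | inj₁ (ti≡i , e₁) | inj₂ (_ , e₂) = inj₁ (ti≡i , sgn-injective (sym (begin
      s₂                           ≡⟨ s₂≡s₁*δ i j j≢i ⟩
      s₁ * (δ (t i) i - δ (t i) j) ≡⟨ cong₂ (λ u v → s₁ * (u - v)) e₁ e₂ ⟩
      s₁ * 1ℤ                      ≡⟨ ℤₚ.*-identityʳ s₁ ⟩
      s₁                           ∎)))
      where open ≡-Reasoning
    ... | inj₂ (_ , e₁) | inj₂ (_ , e₂) = contradiction (begin
      s₂                           ≡⟨ s₂≡s₁*δ i j j≢i ⟩
      s₁ * (δ (t i) i - δ (t i) j) ≡⟨ cong₂ (λ u v → s₁ * (u - v)) e₁ e₂ ⟩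
      s₁ * 0ℤ                      ≡⟨ ℤₚ.*-zeroʳ s₁ ⟩
      0ℤ                           ∎) (sgn≢0 (sign R₂))
      where open ≡-Reasoning

    -- t i is i or any chosen j ≢ i; since n ≥ 3 two different j are available, so t i = i.
    fixed : ∀ i → t i ≡ i × sign R₁ ≡ sign R₂
    fixed i with fixed-or-swapped i (punchIn i zero) (Finₚ.punchInᵢ≢i i zero)
               | fixed-or-swapped i (punchIn i (suc zero)) (Finₚ.punchInᵢ≢i i (suc zero))
    ... | inj₁ ti≡i | _         = ti≡i
    ... | inj₂ _    | inj₁ ti≡i = ti≡i
    ... | inj₂ ti≡j | inj₂ ti≡k with Finₚ.punchIn-injective i zero (suc zero) (trans (sym ti≡j) ti≡k)
    ...   | ()

    perm≈ : perm R₁ Perm.≈ perm R₂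
    perm≈ i = trans (cong (perm R₁ ⟨$⟩ʳ_) (sym (proj₁ (fixed i)))) (Perm.inverseʳ (perm R₁))

  module _ (s : Bool) (π : Permutation′ n) where

    signedPermute : A n → A n
    signedPermute x = tabulate (λ t → sgn s * lookup (vec x) (π ⟨$⟩ˡ t)) , sum≡0
      where
      open ≡-Reasoning
      sum≡0 : sumℤ (tabulate (λ t → sgn s * lookup (vec x) (π ⟨$⟩ˡ t))) ≡ 0ℤ
      sum≡0 = begin
        sumℤ (tabulate (λ t → sgn s * lookup (vec x) (π ⟨$⟩ˡ t)))
          ≡⟨ sumℤ-tabulate (λ t → sgn s * lookup (vec x) (π ⟨$⟩ˡ t)) ⟩
        sum (λ t → sgn s * lookup (vec x) (π ⟨$⟩ˡ t))  ≡⟨ *-distribˡ-sum (sgn s) (λ t → lookup (vec x) (π ⟨$⟩ˡ t)) ⟨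
        sgn s * sum (λ t → lookup (vec x) (π ⟨$⟩ˡ t))  ≡⟨ cong (sgn s *_) (sum-permute (lookup (vec x)) (Perm.flip π)) ⟨
        sgn s * sum (lookup (vec x))                  ≡⟨ cong (sgn s *_) (trans (sym (sumℤ≡sum (vec x))) (proj₂ x)) ⟩
        sgn s * 0ℤ                                    ≡⟨ ℤₚ.*-zeroʳ (sgn s) ⟩
        0ℤ                                            ∎

    lookup-signedPermute : ∀ x t → lookup (vec (signedPermute x)) t ≡ sgn s * lookup (vec x) (π ⟨$⟩ˡ t)
    lookup-signedPermute x = Vecₚ.lookup∘tabulate _

    signedPermute-SignedPermutation : SignedPermutation signedPermute
    signedPermute-SignedPermutation = record
      { sign        = s
      ; perm        = π
      ; lookup-perm = λ x i → trans (lookup-signedPermute x (π ⟨$⟩ʳ i))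
                                    (cong (λ j → sgn s * lookup (vec x) j) (Perm.inverseˡ π))
      }

    signedPermute-+ : ∀ x y → vec (signedPermute (x +A y)) ≡ zipWith _+_ (vec (signedPermute x)) (vec (signedPermute y))
    signedPermute-+ x y = lookup-ext λ t → begin
      lookup (vec (signedPermute (x +A y))) t                           ≡⟨ lookup-signedPermute (x +A y) t ⟩
      sgn s * lookup (zipWith _+_ (vec x) (vec y)) (π ⟨$⟩ˡ t)
        ≡⟨ cong (sgn s *_) (Vecₚ.lookup-zipWith _+_ (π ⟨$⟩ˡ t) (vec x) (vec y)) ⟩
      sgn s * (lookup (vec x) (π ⟨$⟩ˡ t) + lookup (vec y) (π ⟨$⟩ˡ t))     ≡⟨ ℤₚ.*-distribˡ-+ (sgn s) _ _ ⟩
      sgn s * lookup (vec x) (π ⟨$⟩ˡ t) + sgn s * lookup (vec y) (π ⟨$⟩ˡ t)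
        ≡⟨ cong₂ _+_ (lookup-signedPermute x t) (lookup-signedPermute y t) ⟨
      lookup (vec (signedPermute x)) t + lookup (vec (signedPermute y)) t
        ≡⟨ Vecₚ.lookup-zipWith _+_ t (vec (signedPermute x)) (vec (signedPermute y)) ⟨
      lookup (zipWith _+_ (vec (signedPermute x)) (vec (signedPermute y))) t ∎
      where open ≡-Reasoning

    signedPermute-isometry : ∀ x y → ⟨ vec (signedPermute x) , vec (signedPermute y) ⟩ ≡ ⟨ vec x , vec y ⟩
    signedPermute-isometry x y = begin
      ⟨ vec (signedPermute x) , vec (signedPermute y) ⟩    ≡⟨ ⟨⟩≡sum (vec (signedPermute x)) (vec (signedPermute y)) ⟩
      sum (λ t → lookup (vec (signedPermute x)) t * lookup (vec (signedPermute y)) t)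
        ≡⟨ sum-cong-≗ (λ t → trans (cong₂ _*_ (lookup-signedPermute x t) (lookup-signedPermute y t))
                                   (sgn*u*[sgn*v]≡u*v s (lookup (vec x) (π ⟨$⟩ˡ t)) (lookup (vec y) (π ⟨$⟩ˡ t)))) ⟩
      sum (λ t → lookup (vec x) (π ⟨$⟩ˡ t) * lookup (vec y) (π ⟨$⟩ˡ t))
        ≡⟨ sum-permute (λ i → lookup (vec x) i * lookup (vec y) i) (Perm.flip π) ⟨
      sum (λ i → lookup (vec x) i * lookup (vec y) i)      ≡⟨ ⟨⟩≡sum (vec x) (vec y) ⟨
      ⟨ vec x , vec y ⟩                                    ∎
      where open ≡-Reasoning

  signedPermute-inverse : ∀ s (ρ ρ′ : Permutation′ n) → (∀ t → ρ′ ⟨$⟩ˡ (ρ ⟨$⟩ˡ t) ≡ t) →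
                          ∀ x → vec (signedPermute s ρ (signedPermute s ρ′ x)) ≡ vec x
  signedPermute-inverse s ρ ρ′ ρ′∘ρ≗id x = lookup-ext λ t → begin
    lookup (vec (signedPermute s ρ (signedPermute s ρ′ x))) t ≡⟨ lookup-signedPermute s ρ (signedPermute s ρ′ x) t ⟩
    sgn s * lookup (vec (signedPermute s ρ′ x)) (ρ ⟨$⟩ˡ t)    ≡⟨ cong (sgn s *_) (lookup-signedPermute s ρ′ x (ρ ⟨$⟩ˡ t)) ⟩
    sgn s * (sgn s * lookup (vec x) (ρ′ ⟨$⟩ˡ (ρ ⟨$⟩ˡ t)))     ≡⟨ sgn*[sgn*z]≡z s (lookup (vec x) (ρ′ ⟨$⟩ˡ (ρ ⟨$⟩ˡ t))) ⟩
    lookup (vec x) (ρ′ ⟨$⟩ˡ (ρ ⟨$⟩ˡ t))                       ≡⟨ cong (lookup (vec x)) (ρ′∘ρ≗id t) ⟩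
    lookup (vec x) t                                          ∎
    where open ≡-Reasoning

  signedPermuteAut : Bool → Permutation′ n → AutA n
  signedPermuteAut s π = record
    { to       = signedPermute s π
    ; from     = signedPermute s (Perm.flip π)
    ; to-from  = signedPermute-inverse s π (Perm.flip π) (λ _ → Perm.inverseʳ π)
    ; from-to  = signedPermute-inverse s (Perm.flip π) π (λ _ → Perm.inverseˡ π)
    ; additive = signedPermute-+ s π
    ; isometry = signedPermute-isometry s π
    }

  sum-const : (c : ℤ) → sum {n} (λ _ → c) ≡ + n * c
  sum-const {zero}  c = refl
  sum-const {suc n} c = trans (cong (_+_ c) (sum-const {n} c)) (sym (ℤₚ.suc-* (+ n) c))

  -- Summing over all coordinates: n · c = Σ y - s · Σ z = 0.
  shift≡0 : (π : Permutation′ (suc n)) {y z : Fin (suc n) → ℤ} (s c : ℤ) → sum y ≡ 0ℤ → sum z ≡ 0ℤ →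
            (∀ i → y (π ⟨$⟩ʳ i) ≡ s * z i + c) → c ≡ 0ℤ
  shift≡0 {n} π {y} {z} s c Σy≡0 Σz≡0 y∘π≡ = ℤₚ.*-cancelˡ-≡ (+ suc n) c 0ℤ (begin
    + suc n * c                   ≡⟨ sum-const {suc n} c ⟨
    Σc                            ≡⟨ ℤₚ.+-identityˡ Σc ⟨
    0ℤ + Σc                       ≡⟨ cong (_+ Σc) (trans (sym (ℤₚ.*-zeroʳ s)) (cong (s *_) (sym Σz≡0))) ⟩
    s * sum z + Σc                ≡⟨ cong (_+ Σc) (*-distribˡ-sum s z) ⟩
    sum (λ i → s * z i) + Σc      ≡⟨ ∑-distrib-+ (λ i → s * z i) (λ _ → c) ⟨
    sum (λ i → s * z i + c)       ≡⟨ sum-cong-≗ y∘π≡ ⟨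
    sum (λ i → y (π ⟨$⟩ʳ i))      ≡⟨ sum-permute y π ⟨
    sum y                         ≡⟨ Σy≡0 ⟩
    0ℤ                            ≡⟨ ℤₚ.*-zeroʳ (+ suc n) ⟨
    + suc n * 0ℤ                  ∎)
    where
    open ≡-Reasoning
    Σc : ℤ
    Σc = sum {suc n} (λ _ → c)

  -- Isometry against the roots e₀ - e_{k+1} gives (T x)_{σ i} = ± x_i + c for all i, and c = 0 by shift≡0.
  star⇒SignedPermutation : ∀ {m} (T : A (suc m) → A (suc m)) →
                           (∀ x y → ⟨ vec (T x) , vec (T y) ⟩ ≡ ⟨ vec x , vec y ⟩) →
                           (s : Bool) (a₀ : Fin (suc m)) (b : Fin m → Fin (suc m)) →
                           (∀ k → a₀ ≢ b k) → Injective _≡_ _≡_ b →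
                           (∀ k → vec (T (rootA zero (suc k))) ≡ root± s a₀ (b k)) →
                           SignedPermutation T
  star⇒SignedPermutation {m} T isometry s a₀ b a₀≢b b-inj T-root =
    record { sign = s ; perm = π ; lookup-perm = lookup-π }
    where
    σ : Fin (suc m) → Fin (suc m)
    σ zero    = a₀
    σ (suc k) = b k

    σ-inj : Injective _≡_ _≡_ σ
    σ-inj {zero}  {zero}  _      = refl
    σ-inj {zero}  {suc l} a₀≡bl  = contradiction a₀≡bl (a₀≢b l)
    σ-inj {suc k} {zero}  bk≡a₀  = contradiction (sym bk≡a₀) (a₀≢b k)
    σ-inj {suc k} {suc l} bk≡bl  = cong suc (b-inj bk≡bl)

    π : Permutation′ (suc m)
    π = injective⇒permutation σ σ-inj

    module _ (x : A (suc m)) where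
      y z : Fin (suc m) → ℤ
      y = lookup (vec (T x))
      z = lookup (vec x)

      edge : ∀ k → sgn s * (y a₀ - y (b k)) ≡ z zero - z (suc k)
      edge k = begin
        sgn s * (y a₀ - y (b k))                      ≡⟨ ⟨x,root±⟩ (vec (T x)) s a₀ (b k) ⟨
        ⟨ vec (T x) , root± s a₀ (b k) ⟩              ≡⟨ cong (λ v → ⟨ vec (T x) , v ⟩) (T-root k) ⟨
        ⟨ vec (T x) , vec (T (rootA zero (suc k))) ⟩  ≡⟨ isometry x (rootA zero (suc k)) ⟩
        ⟨ vec x , root zero (suc k) ⟩                 ≡⟨ ⟨x,root⟩ (vec x) zero (suc k) ⟩
        z zero - z (suc k)                            ∎
        where open ≡-Reasoning

      c : ℤ
      c = y a₀ - sgn s * z zero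

      shifted : ∀ i → y (σ i) ≡ sgn s * z i + c
      shifted zero    = rearrange (y a₀) (sgn s) (z zero)
        where
        rearrange : ∀ u e p → u ≡ e * p + (u - e * p)
        rearrange = solve-∀
      shifted (suc k) = begin
        y (b k)                                    ≡⟨ rearrange₁ (y a₀) (y (b k)) ⟩
        y a₀ - 1ℤ * (y a₀ - y (b k))               ≡⟨ cong (λ e → y a₀ - e * (y a₀ - y (b k))) (sgn*sgn≡1 s) ⟨
        y a₀ - sgn s * sgn s * (y a₀ - y (b k))    ≡⟨ cong (_-_ (y a₀)) (ℤₚ.*-assoc (sgn s) (sgn s) (y a₀ - y (b k))) ⟩
        y a₀ - sgn s * (sgn s * (y a₀ - y (b k)))  ≡⟨ cong (λ w → y a₀ - sgn s * w) (edge k) ⟩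
        y a₀ - sgn s * (z zero - z (suc k))        ≡⟨ rearrange₂ (y a₀) (sgn s) (z zero) (z (suc k)) ⟩
        sgn s * z (suc k) + c                      ∎
        where
        open ≡-Reasoning
        rearrange₁ : ∀ u v → v ≡ u - 1ℤ * (u - v)
        rearrange₁ = solve-∀
        rearrange₂ : ∀ u e p q → u - e * (p - q) ≡ e * q + (u - e * p)
        rearrange₂ = solve-∀

      lookup-π : ∀ i → y (π ⟨$⟩ʳ i) ≡ sgn s * z i
      lookup-π i = trans (shifted i) (trans (cong (_+_ (sgn s * z i)) c≡0) (ℤₚ.+-identityʳ (sgn s * z i)))
        where
        c≡0 : c ≡ 0ℤ
        c≡0 = shift≡0 π {y} {z} (sgn s) c (trans (sym (sumℤ≡sum (vec (T x)))) (proj₂ (T x)))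
                                  (trans (sym (sumℤ≡sum (vec x))) (proj₂ x)) shifted

  Overlap : (a b c d : Fin n) → Set
  Overlap a b c d = (a ≡ c × b ≢ d) ⊎ (b ≡ d × a ≢ c)

  overlapping⇒star : ∀ {m} (a b : Fin (suc (suc m)) → Fin n) →
                     (∀ k l → k ≢ l → Overlap (a k) (b k) (a l) (b l)) → a zero ≡ a (suc zero) →
                     (∀ k → a k ≡ a zero) × Injective _≡_ _≡_ b
  overlapping⇒star a b overlaps a₀≡a₁ = a≡a₀ , b-inj
    where
    b₀≢b₁ : b zero ≢ b (suc zero)
    b₀≢b₁ with overlaps zero (suc zero) (λ ())
    ... | inj₁ (_ , b₀≢b₁) = b₀≢b₁
    ... | inj₂ (_ , a₀≢a₁) = contradiction a₀≡a₁ a₀≢a₁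

    a≡a₀ : ∀ k → a k ≡ a zero
    a≡a₀ zero          = refl
    a≡a₀ (suc zero)    = sym a₀≡a₁
    a≡a₀ (suc (suc j)) with overlaps (suc (suc j)) zero (λ ()) | overlaps (suc (suc j)) (suc zero) (λ ())
    ... | inj₁ (ak≡a₀ , _) | _                = ak≡a₀
    ... | inj₂ _           | inj₁ (ak≡a₁ , _) = trans ak≡a₁ (sym a₀≡a₁)
    ... | inj₂ (bk≡b₀ , _) | inj₂ (bk≡b₁ , _) = contradiction (trans (sym bk≡b₀) bk≡b₁) b₀≢b₁

    b-inj : Injective _≡_ _≡_ b
    b-inj {k} {l} bk≡bl with k ≟ l
    ... | yes k≡l = k≡l
    ... | no  k≢l with overlaps k l k≢l
    ...   | inj₁ (_ , bk≢bl) = contradiction bk≡bl bk≢bl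
    ...   | inj₂ (_ , ak≢al) = contradiction (trans (a≡a₀ k) (sym (a≡a₀ l))) ak≢al

  AutA-root : (φ : AutA n) {a b : Fin n} → a ≢ b → ∃₂ λ c d → c ≢ d × vec (AutA.to φ (rootA a b)) ≡ root c d
  AutA-root φ {a} {b} a≢b =
    ‖v‖²≡2⇒root (vec (to (rootA a b))) (proj₂ (to (rootA a b))) (ℤₚ.+-injective (begin
      + ‖ vec (to (rootA a b)) ‖²                        ≡⟨ ⟨v,v⟩≡‖v‖² (vec (to (rootA a b))) ⟨
      ⟨ vec (to (rootA a b)) , vec (to (rootA a b)) ⟩    ≡⟨ isometry (rootA a b) (rootA a b) ⟩
      ⟨ root a b , root a b ⟩                            ≡⟨ ⟨root,root⟩≡2 a≢b ⟩
      + 2                                                ∎))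
    where
    open AutA φ
    open ≡-Reasoning

  -- The images of the roots e₀ - e_{k+1} are roots with pairwise inner product 1, so they form a star.
  -- Opaque: only the specification matters, and unfolding the construction makes type checking crawl.
  opaque
    AutA⇒SignedPermutation : ∀ {p} (φ : AutA (suc (suc (suc p)))) → SignedPermutation (AutA.to φ)
    AutA⇒SignedPermutation {p} φ = from-overlap (overlaps zero (suc zero) (λ ()))
      where
      open AutA φ
      r : Fin (suc (suc p)) → A (suc (suc (suc p)))
      r k = rootA zero (suc k)
      image : ∀ k → ∃₂ λ c d → c ≢ d × vec (to (r k)) ≡ root c d
      image k = AutA-root φ {zero} {suc k} (λ ())
      a b : Fin (suc (suc p)) → Fin (suc (suc (suc p)))
      a k = proj₁ (image k)
      b k = proj₁ (proj₂ (image k))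
      a≢b : ∀ k → a k ≢ b k
      a≢b k = proj₁ (proj₂ (proj₂ (image k)))
      to-r≡root : ∀ k → vec (to (r k)) ≡ root (a k) (b k)
      to-r≡root k = proj₂ (proj₂ (proj₂ (image k)))

      overlaps : ∀ k l → k ≢ l → Overlap (a k) (b k) (a l) (b l)
      overlaps k l k≢l = root-overlap (a≢b k) (a≢b l) (begin
        ⟨ root (a k) (b k) , root (a l) (b l) ⟩    ≡⟨ cong₂ ⟨_,_⟩ (to-r≡root k) (to-r≡root l) ⟨
        ⟨ vec (to (r k)) , vec (to (r l)) ⟩        ≡⟨ isometry (r k) (r l) ⟩
        ⟨ root zero (suc k) , root zero (suc l) ⟩  ≡⟨ ⟨root0,root0⟩≡1 k≢l ⟩
        1ℤ                                         ∎)
        where open ≡-Reasoning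

      from-overlap : Overlap (a zero) (b zero) (a (suc zero)) (b (suc zero)) → SignedPermutation to
      from-overlap (inj₁ (a₀≡a₁ , _)) =
        star⇒SignedPermutation to isometry false (a zero) b (λ k a₀≡bk → a≢b k (trans (a≡a₀ k) a₀≡bk)) b-inj
          (λ k → trans (to-r≡root k) (cong (λ c → root c (b k)) (a≡a₀ k)))
        where
        a≡a₀ : ∀ k → a k ≡ a zero
        a≡a₀ = proj₁ (overlapping⇒star a b overlaps a₀≡a₁)
        b-inj : Injective _≡_ _≡_ b
        b-inj = proj₂ (overlapping⇒star a b overlaps a₀≡a₁)
      from-overlap (inj₂ (b₀≡b₁ , _)) =
        star⇒SignedPermutation to isometry true (b zero) a (λ k b₀≡ak → a≢b k (trans (sym b₀≡ak) (sym (b≡b₀ k)))) a-inj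
          (λ k → trans (to-r≡root k) (cong (root (a k)) (b≡b₀ k)))
        where
        overlaps′ : ∀ k l → k ≢ l → Overlap (b k) (a k) (b l) (a l)
        overlaps′ k l k≢l = Sum.swap (overlaps k l k≢l)
        b≡b₀ : ∀ k → b k ≡ b zero
        b≡b₀ = proj₁ (overlapping⇒star b a overlaps′ b₀≡b₁)
        a-inj : Injective _≡_ _≡_ a
        a-inj = proj₂ (overlapping⇒star b a overlaps′ b₀≡b₁)

open SignedPermutations

module Weights {c ℓ} (G : AbelianGroup c ℓ) where
  open import Algebra.Properties.Semiring.Sum ℤₚ.+-*-semiring using () renaming (sum to ℤsum)
  open AbelianGroup G
  open import Algebra.Properties.AbelianGroup G using (⁻¹-∙-comm; xyx⁻¹≈y)
  open import Algebra.Properties.Group group using (ε⁻¹≈ε; ⁻¹-involutive; inverseˡ-unique; identityʳ-unique)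
  open import Algebra.Properties.CommutativeMonoid.Sum commutativeMonoid
    using (sum; sum-cong-≋; ∑-distrib-+; sum-permute; sum-replicate-zero)
  open import Algebra.Properties.Monoid.Mult monoid using (×-homo-+; ×-congʳ) renaming (_×_ to _·_)
  open import Algebra.Properties.CommutativeMonoid.Mult commutativeMonoid using (×-distrib-+)
  open import Algebra.Solver.CommutativeMonoid commutativeMonoid using (solve; _⊜_; _⊕_)
  open import Relation.Binary.Reasoning.Setoid setoid

  x∙y-x∙z≈y-z : ∀ x y z → (x ∙ y) - (x ∙ z) ≈ y - z
  x∙y-x∙z≈y-z x y z = begin
    (x ∙ y) ∙ (x ∙ z) ⁻¹       ≈⟨ ∙-congˡ (⁻¹-∙-comm x z) ⟨
    (x ∙ y) ∙ (x ⁻¹ ∙ z ⁻¹)    ≈⟨ solve 4 (λ x y x′ z′ → (x ⊕ y) ⊕ (x′ ⊕ z′) ⊜ (x ⊕ x′) ⊕ (y ⊕ z′)) refl x y (x ⁻¹) (z ⁻¹) ⟩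
    (x ∙ x ⁻¹) ∙ (y ∙ z ⁻¹)    ≈⟨ ∙-congʳ (inverseʳ x) ⟩
    ε ∙ (y - z)                ≈⟨ identityˡ (y - z) ⟩
    y - z                      ∎

  x∙[y-x]≈y : ∀ x y → x ∙ (y - x) ≈ y
  x∙[y-x]≈y x y = trans (sym (assoc x y (x ⁻¹))) (xyx⁻¹≈y x y)

  x∙z-y∙z≈x-y : ∀ x y z → (x ∙ z) - (y ∙ z) ≈ x - y
  x∙z-y∙z≈x-y x y z = trans (∙-cong (comm x z) (⁻¹-cong (comm y z))) (x∙y-x∙z≈y-z z x y)

  [a-b]∙[h-c]≈ε⇒a-h≈[b-h]∙[c-h] : ∀ a b c h → (a - b) ∙ (h - c) ≈ ε → a - h ≈ (b - h) ∙ (c - h)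
  [a-b]∙[h-c]≈ε⇒a-h≈[b-h]∙[c-h] a b c h ≈ε = sym (begin
    (b - h) ∙ (c - h)                              ≈⟨ identityʳ _ ⟨
    ((b - h) ∙ (c - h)) ∙ ε                        ≈⟨ ∙-congˡ ≈ε ⟨
    ((b - h) ∙ (c - h)) ∙ ((a - b) ∙ (h - c))
      ≈⟨ solve 7 (λ b h′ c a b′ h c′ → ((b ⊕ h′) ⊕ (c ⊕ h′)) ⊕ ((a ⊕ b′) ⊕ (h ⊕ c′))
                                      ⊜ (a ⊕ h′) ⊕ ((b ⊕ b′) ⊕ ((c ⊕ c′) ⊕ (h ⊕ h′))))
                 refl b (h ⁻¹) c a (b ⁻¹) h (c ⁻¹) ⟩
    (a - h) ∙ ((b - b) ∙ ((c - c) ∙ (h - h)))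
      ≈⟨ ∙-congˡ (trans (∙-cong (inverseʳ b) (trans (∙-cong (inverseʳ c) (inverseʳ h)) (identityˡ ε))) (identityˡ ε)) ⟩
    (a - h) ∙ ε                                    ≈⟨ identityʳ _ ⟩
    a - h                                          ∎)

  natMul≡· : ∀ k x → natMul G k x ≡ k · x
  natMul≡· zero    x = ≡.refl
  natMul≡· (suc k) x = ≡.cong (x ∙_) (natMul≡· k x)

  natMul-+ : ∀ a b x → natMul G (a ℕ.+ b) x ≈ natMul G a x ∙ natMul G b x
  natMul-+ a b x rewrite natMul≡· (a ℕ.+ b) x | natMul≡· a x | natMul≡· b x = ×-homo-+ x a b

  natMul-cong : ∀ k {x y} → x ≈ y → natMul G k x ≈ natMul G k y
  natMul-cong k {x} {y} x≈y rewrite natMul≡· k x | natMul≡· k y = ×-congʳ k x≈y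

  natMul-∙ : ∀ k x y → natMul G k (x ∙ y) ≈ natMul G k x ∙ natMul G k y
  natMul-∙ k x y rewrite natMul≡· k (x ∙ y) | natMul≡· k x | natMul≡· k y = ×-distrib-+ x y k

  natMul-ε : ∀ k → natMul G k ε ≈ ε
  natMul-ε zero    = refl
  natMul-ε (suc k) = trans (identityˡ _) (natMul-ε k)

  intMul-cong : ∀ k {x y} → x ≈ y → intMul G k x ≈ intMul G k y
  intMul-cong (+ k)    x≈y = natMul-cong k x≈y
  intMul-cong -[1+ k ] x≈y = ⁻¹-cong (natMul-cong (suc k) x≈y)

  intMul-ε : ∀ k → intMul G k ε ≈ ε
  intMul-ε (+ k)    = natMul-ε k
  intMul-ε -[1+ k ] = trans (⁻¹-cong (natMul-ε (suc k))) ε⁻¹≈ε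

  intMul-neg : ∀ k x → intMul G (ℤ.- k) x ≈ intMul G k x ⁻¹
  intMul-neg (+ zero)  x = sym ε⁻¹≈ε
  intMul-neg (+ suc _) x = refl
  intMul-neg -[1+ _ ]  x = sym (⁻¹-involutive _)

  intMul-∙ : ∀ k x y → intMul G k (x ∙ y) ≈ intMul G k x ∙ intMul G k y
  intMul-∙ (+ k)    = natMul-∙ k
  intMul-∙ -[1+ k ] x y = trans (⁻¹-cong (natMul-∙ (suc k) x y)) (sym (⁻¹-∙-comm _ _))

  intMul-⊖ : ∀ a b x → intMul G (a ⊖ b) x ≈ natMul G a x - natMul G b x
  intMul-⊖ zero zero x = sym (inverseʳ ε)
  intMul-⊖ zero (suc b) x = begin
    intMul G (zero ⊖ suc b) x    ≡⟨⟩
    natMul G (suc b) x ⁻¹        ≈⟨ identityˡ _ ⟨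
    ε - natMul G (suc b) x       ∎
  intMul-⊖ (suc a) zero x = begin
    intMul G (suc a ⊖ zero) x       ≡⟨⟩
    natMul G (suc a) x              ≈⟨ identityʳ _ ⟨
    natMul G (suc a) x ∙ ε          ≈⟨ ∙-congˡ ε⁻¹≈ε ⟨
    natMul G (suc a) x - ε          ∎
  intMul-⊖ (suc a) (suc b) x = begin
    intMul G (suc a ⊖ suc b) x                      ≡⟨ ≡.cong (λ k → intMul G k x) (ℤₚ.[1+m]⊖[1+n]≡m⊖n a b) ⟩
    intMul G (a ⊖ b) x                              ≈⟨ intMul-⊖ a b x ⟩
    natMul G a x - natMul G b x                     ≈⟨ x∙y-x∙z≈y-z x _ _ ⟨
    (x ∙ natMul G a x) - (x ∙ natMul G b x)         ∎

  intMul-+ : ∀ i j x → intMul G (i ℤ.+ j) x ≈ intMul G i x ∙ intMul G j x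
  intMul-+ (+ a)    (+ b)    x = natMul-+ a b x
  intMul-+ (+ a)    -[1+ b ] x = intMul-⊖ a (suc b) x
  intMul-+ -[1+ a ] (+ b)    x = trans (intMul-⊖ b (suc a) x) (comm _ _)
  intMul-+ -[1+ a ] -[1+ b ] x = begin
    (x ∙ (x ∙ natMul G (a ℕ.+ b) x)) ⁻¹                ≡⟨ ≡.cong (λ k → (x ∙ natMul G k x) ⁻¹) (ℕₚ.+-suc a b) ⟨
    (x ∙ natMul G (a ℕ.+ suc b) x) ⁻¹                  ≈⟨ ⁻¹-cong (natMul-+ (suc a) (suc b) x) ⟩
    (natMul G (suc a) x ∙ natMul G (suc b) x) ⁻¹       ≈⟨ ⁻¹-∙-comm _ _ ⟨
    intMul G -[1+ a ] x ∙ intMul G -[1+ b ] x          ∎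

  module Homomorphism {f : Carrier → Carrier} (f-cong : ∀ {x y} → x ≈ y → f x ≈ f y)
                      (f-homo : ∀ x y → f (x ∙ y) ≈ f x ∙ f y) where

    f-ε : f ε ≈ ε
    f-ε = identityʳ-unique (f ε) (f ε) (trans (sym (f-homo ε ε)) (f-cong (identityˡ ε)))

    f-⁻¹ : ∀ x → f (x ⁻¹) ≈ f x ⁻¹
    f-⁻¹ x = inverseˡ-unique (f (x ⁻¹)) (f x) (trans (sym (f-homo (x ⁻¹) x)) (trans (f-cong (inverseˡ x)) f-ε))

    f-natMul : ∀ k x → f (natMul G k x) ≈ natMul G k (f x)
    f-natMul zero    x = f-ε
    f-natMul (suc k) x = trans (f-homo x (natMul G k x)) (∙-congˡ (f-natMul k x))

    f-intMul : ∀ k x → f (intMul G k x) ≈ intMul G k (f x)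
    f-intMul (+ k)    x = f-natMul k x
    f-intMul -[1+ k ] x = trans (f-⁻¹ (natMul G (suc k) x)) (⁻¹-cong (f-natMul (suc k) x))

    f-sum : (h : Fin n → Carrier) → f (sum h) ≈ sum (λ i → f (h i))
    f-sum {zero}  h = f-ε
    f-sum {suc n} h = trans (f-homo (h zero) (sum (λ i → h (suc i)))) (∙-congˡ (f-sum (λ i → h (suc i))))

  sum-⁻¹ : (h : Fin n → Carrier) → sum (λ i → h i ⁻¹) ≈ sum h ⁻¹
  sum-⁻¹ {zero}  h = sym ε⁻¹≈ε
  sum-⁻¹ {suc n} h = trans (∙-congˡ (sum-⁻¹ (λ i → h (suc i)))) (⁻¹-∙-comm (h zero) (sum (λ i → h (suc i))))

  sum-intMul : (k : Fin n → ℤ) (x : Carrier) → sum (λ i → intMul G (k i) x) ≈ intMul G (ℤsum k) x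
  sum-intMul {zero}  k x = refl
  sum-intMul {suc n} k x = trans (∙-congˡ (sum-intMul (λ i → k (suc i)) x)) (sym (intMul-+ (k zero) _ x))

  sum-intMul-δ : (c : Fin n → Carrier) (a : Fin n) → sum (λ i → intMul G (δ i a) (c i)) ≈ c a
  sum-intMul-δ {suc n} c zero    = trans (∙-cong (identityʳ (c zero)) (sum-replicate-zero n)) (identityʳ (c zero))
  sum-intMul-δ {suc n} c (suc a) = trans (identityˡ _) (sum-intMul-δ (λ i → c (suc i)) a)

  gsum≈sum : (h : Fin n → Carrier) → gsum G h ≈ sum h
  gsum≈sum {zero}  h = refl
  gsum≈sum {suc n} h = ∙-congˡ (gsum≈sum (λ i → h (suc i)))

  signed : Bool → Carrier → Carrier
  signed false x = x
  signed true  x = x ⁻¹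

  signed-cong : ∀ s {x y} → x ≈ y → signed s x ≈ signed s y
  signed-cong false x≈y = x≈y
  signed-cong true  x≈y = ⁻¹-cong x≈y

  signed≈ε⇒≈ε : ∀ s {x} → signed s x ≈ ε → x ≈ ε
  signed≈ε⇒≈ε false x≈ε  = x≈ε
  signed≈ε⇒≈ε true  x⁻¹≈ε = trans (sym (⁻¹-involutive _)) (trans (⁻¹-cong x⁻¹≈ε) ε⁻¹≈ε)

  ≈ε⇒signed≈ε : ∀ s {x} → x ≈ ε → signed s x ≈ ε
  ≈ε⇒signed≈ε false x≈ε = x≈ε
  ≈ε⇒signed≈ε true  x≈ε = trans (⁻¹-cong x≈ε) ε⁻¹≈ε

  intMul-sgn : ∀ s k x → intMul G (sgn s ℤ.* k) x ≈ signed s (intMul G k x)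
  intMul-sgn false k x = reflexive (≡.cong (λ j → intMul G j x) (ℤₚ.*-identityˡ k))
  intMul-sgn true  k x = trans (reflexive (≡.cong (λ j → intMul G j x) (ℤₚ.-1*i≡-i k))) (intMul-neg k x)

  sum-signed : ∀ s (h : Fin n → Carrier) → sum (λ i → signed s (h i)) ≈ signed s (sum h)
  sum-signed false h = refl
  sum-signed true  h = sum-⁻¹ h

  -- weight c x = Σᵢ xᵢ · cᵢ; for c = g its kernel on A_{n-1} is L_G (weight≈gsum).
  weight : (Fin n → Carrier) → Vec ℤ n → Carrier
  weight c x = sum (λ i → intMul G (lookup x i) (c i))

  weight-+ : (c : Fin n → Carrier) (u v : Vec ℤ n) → weight c (zipWith ℤ._+_ u v) ≈ weight c u ∙ weight c v
  weight-+ c u v = begin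
    weight c (zipWith ℤ._+_ u v)                                            ≈⟨ sum-cong-≋ lookup-+ ⟩
    sum (λ i → intMul G (lookup u i) (c i) ∙ intMul G (lookup v i) (c i))
      ≈⟨ ∑-distrib-+ (λ i → intMul G (lookup u i) (c i)) (λ i → intMul G (lookup v i) (c i)) ⟩
    weight c u ∙ weight c v                                                  ∎
    where
    lookup-+ : ∀ i → intMul G (lookup (zipWith ℤ._+_ u v) i) (c i)
                   ≈ intMul G (lookup u i) (c i) ∙ intMul G (lookup v i) (c i)
    lookup-+ i = trans (reflexive (≡.cong (λ k → intMul G k (c i)) (Vecₚ.lookup-zipWith ℤ._+_ i u v)))
                       (intMul-+ (lookup u i) (lookup v i) (c i))

  weight-root : (c : Fin n → Carrier) (a b : Fin n) → weight c (root a b) ≈ c a - c b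
  weight-root c a b = begin
    weight c (root a b)                                                 ≈⟨ sum-cong-≋ lookup-root′ ⟩
    sum (λ i → intMul G (δ i a) (c i) ∙ intMul G (δ i b) (c i) ⁻¹)
      ≈⟨ ∑-distrib-+ (λ i → intMul G (δ i a) (c i)) (λ i → intMul G (δ i b) (c i) ⁻¹) ⟩
    sum (λ i → intMul G (δ i a) (c i)) ∙ sum (λ i → intMul G (δ i b) (c i) ⁻¹)
      ≈⟨ ∙-congˡ (sum-⁻¹ (λ i → intMul G (δ i b) (c i))) ⟩
    sum (λ i → intMul G (δ i a) (c i)) - sum (λ i → intMul G (δ i b) (c i))
      ≈⟨ ∙-cong (sum-intMul-δ c a) (⁻¹-cong (sum-intMul-δ c b)) ⟩
    c a - c b                                                            ∎
    where
    lookup-root′ : ∀ i → intMul G (lookup (root a b) i) (c i) ≈ intMul G (δ i a) (c i) ∙ intMul G (δ i b) (c i) ⁻¹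
    lookup-root′ i = begin
      intMul G (lookup (root a b) i) (c i)                         ≡⟨ ≡.cong (λ k → intMul G k (c i)) (lookup-root a b i) ⟩
      intMul G (δ i a ℤ.- δ i b) (c i)                             ≈⟨ intMul-+ (δ i a) (ℤ.- δ i b) (c i) ⟩
      intMul G (δ i a) (c i) ∙ intMul G (ℤ.- δ i b) (c i)          ≈⟨ ∙-congˡ (intMul-neg (δ i b) (c i)) ⟩
      intMul G (δ i a) (c i) ∙ intMul G (δ i b) (c i) ⁻¹           ∎

  weight-SignedPermutation : {T : A n → A n} (R : SignedPermutation T) (c : Fin n → Carrier) (x : A n) →
    weight c (vec (T x)) ≈ signed (SignedPermutation.sign R) (weight (λ i → c (SignedPermutation.perm R ⟨$⟩ʳ i)) (vec x))
  weight-SignedPermutation {T = T} R c x = begin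
    weight c (vec (T x))
      ≈⟨ sum-permute (λ t → intMul G (lookup (vec (T x)) t) (c t)) π ⟩
    sum (λ i → intMul G (lookup (vec (T x)) (π ⟨$⟩ʳ i)) (c (π ⟨$⟩ʳ i)))  ≈⟨ sum-cong-≋ signed-term ⟩
    sum (λ i → signed s (intMul G (lookup (vec x) i) (c (π ⟨$⟩ʳ i))))
      ≈⟨ sum-signed s (λ i → intMul G (lookup (vec x) i) (c (π ⟨$⟩ʳ i))) ⟩
    signed s (weight (λ i → c (π ⟨$⟩ʳ i)) (vec x))                       ∎
    where
    open SignedPermutation R renaming (sign to s; perm to π)
    signed-term : ∀ i → intMul G (lookup (vec (T x)) (π ⟨$⟩ʳ i)) (c (π ⟨$⟩ʳ i))
                      ≈ signed s (intMul G (lookup (vec x) i) (c (π ⟨$⟩ʳ i)))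
    signed-term i = trans (reflexive (≡.cong (λ k → intMul G k (c (π ⟨$⟩ʳ i))) (lookup-perm x i)))
                          (intMul-sgn s (lookup (vec x) i) (c (π ⟨$⟩ʳ i)))

  weight-affine : (α : AutG G) (h : Carrier) {c c′ : Fin n → Carrier} → (∀ i → c′ i ≈ h ∙ AutG.f α (c i)) →
                  ∀ x → weight c′ x ≈ intMul G (sumℤ x) h ∙ AutG.f α (weight c x)
  weight-affine {n} α h {c} {c′} c′≈h+αc x = begin
    weight c′ x                                                            ≈⟨ sum-cong-≋ split ⟩
    sum (λ i → intMul G (x′ i) h ∙ f (intMul G (x′ i) (c i)))
      ≈⟨ ∑-distrib-+ (λ i → intMul G (x′ i) h) (λ i → f (intMul G (x′ i) (c i))) ⟩
    sum (λ i → intMul G (x′ i) h) ∙ sum (λ i → f (intMul G (x′ i) (c i)))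
      ≈⟨ ∙-cong (sum-intMul x′ h) (sym (f-sum (λ i → intMul G (x′ i) (c i)))) ⟩
    intMul G (ℤsum x′) h ∙ f (weight c x)
      ≡⟨ ≡.cong (λ k → intMul G k h ∙ f (weight c x)) (sumℤ≡sum x) ⟨
    intMul G (sumℤ x) h ∙ f (weight c x)                                   ∎
    where
    open AutG α using (f; f-cong; f-homo)
    open Homomorphism f-cong f-homo using (f-intMul; f-sum)
    x′ : Fin n → ℤ
    x′ = lookup x
    split : ∀ i → intMul G (x′ i) (c′ i) ≈ intMul G (x′ i) h ∙ f (intMul G (x′ i) (c i))
    split i = begin
      intMul G (x′ i) (c′ i)                           ≈⟨ intMul-cong (x′ i) (c′≈h+αc i) ⟩
      intMul G (x′ i) (h ∙ f (c i))                    ≈⟨ intMul-∙ (x′ i) h (f (c i)) ⟩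
      intMul G (x′ i) h ∙ intMul G (x′ i) (f (c i))    ≈⟨ ∙-congˡ (f-intMul (x′ i) (c i)) ⟨
      intMul G (x′ i) h ∙ f (intMul G (x′ i) (c i))    ∎

  weight≈gsum : ∀ {m} (g : Fin (suc m) → Carrier) → g zero ≈ ε → ∀ x →
                weight g x ≈ gsum G (λ j → intMul G (lookup x (suc j)) (g (suc j)))
  weight≈gsum g g₀≈ε x = begin
    intMul G (lookup x zero) (g zero) ∙ sum (λ j → intMul G (lookup x (suc j)) (g (suc j)))
      ≈⟨ ∙-congʳ (trans (intMul-cong (lookup x zero) g₀≈ε) (intMul-ε (lookup x zero))) ⟩
    ε ∙ sum (λ j → intMul G (lookup x (suc j)) (g (suc j)))   ≈⟨ identityˡ _ ⟩
    sum (λ j → intMul G (lookup x (suc j)) (g (suc j)))       ≈⟨ gsum≈sum (λ j → intMul G (lookup x (suc j)) (g (suc j))) ⟨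
    gsum G (λ j → intMul G (lookup x (suc j)) (g (suc j)))    ∎

module Stabiliser {c ℓ} (G : AbelianGroup c ℓ) {p : ℕ} (g : Fin (suc (suc (suc p))) → AbelianGroup.Carrier G)
                  (g-bij : Bijective _≡_ (AbelianGroup._≈_ G) g)
                  (g₀≈ε : AbelianGroup._≈_ G (g zero) (AbelianGroup.ε G)) where
  open AbelianGroup G
  open Weights G
  open import Algebra.Properties.Group group using (∙-cancelˡ; ∙-cancelʳ)
  open import Algebra.Properties.AbelianGroup G using (xyx⁻¹≈y)
  open import Relation.Binary.Reasoning.Setoid setoid

  private
    N : ℕ
    N = suc (suc (suc p))

  index : Carrier → Fin N
  index y = proj₁ (proj₂ g-bij y)

  g-index : ∀ y → g (index y) ≈ y
  g-index y = proj₂ (proj₂ g-bij y) ≡.refl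

  g-injective : Injective _≡_ _≈_ g
  g-injective = proj₁ g-bij

  index-g : ∀ i → index (g i) ≡ i
  index-g i = g-injective (g-index (g i))

  index-cong : ∀ {y z} → y ≈ z → index y ≡ index z
  index-cong {y} {z} y≈z = g-injective (trans (g-index y) (trans y≈z (sym (g-index z))))

  InL⇒weight≈ε : ∀ x → InL G g x → weight g (vec x) ≈ ε
  InL⇒weight≈ε x = trans (weight≈gsum g g₀≈ε (vec x))

  weight≈ε⇒InL : ∀ x → weight g (vec x) ≈ ε → InL G g x
  weight≈ε⇒InL x = trans (sym (weight≈gsum g g₀≈ε (vec x)))

  signedPermutation : (φ : Stab G g) → SignedPermutation (Stab.to φ)
  signedPermutation φ = AutA⇒SignedPermutation (Stab.aut φ)

  sign : Stab G g → Bool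
  sign φ = SignedPermutation.sign (signedPermutation φ)

  σ : Stab G g → Fin N → Fin N
  σ φ i = SignedPermutation.perm (signedPermutation φ) ⟨$⟩ʳ i

  σ-injective : ∀ φ → Injective _≡_ _≡_ (σ φ)
  σ-injective φ σi≡σj = ≡.trans (≡.sym (Perm.inverseˡ π)) (≡.trans (≡.cong (π ⟨$⟩ˡ_) σi≡σj) (Perm.inverseˡ π))
    where
    π : Permutation′ N
    π = SignedPermutation.perm (signedPermutation φ)

  -- φ relabels the coordinates, i.e. the elements of G, by σ φ; as a map on G this is
  -- y ↦ translation φ ∙ linear φ y, and (sign φ , translation φ , linear φ) is the image of φ.
  shift : (Fin N → Fin N) → Carrier
  shift f = g (f zero)

  linearOf : (Fin N → Fin N) → Carrier → Carrier
  linearOf f y = g (f (index y)) - shift f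

  shift-cong : ∀ {f f′} → (∀ i → f i ≡ f′ i) → shift f ≈ shift f′
  shift-cong f≗f′ = reflexive (≡.cong g (f≗f′ zero))

  linearOf-cong : ∀ {f f′} → (∀ i → f i ≡ f′ i) → ∀ y → linearOf f y ≈ linearOf f′ y
  linearOf-cong f≗f′ y = ∙-cong (reflexive (≡.cong g (f≗f′ (index y)))) (⁻¹-cong (shift-cong f≗f′))

  translation : Stab G g → Carrier
  translation φ = shift (σ φ)

  linear : Stab G g → Carrier → Carrier
  linear φ = linearOf (σ φ)

  weight∘σ≈ε : ∀ φ x → weight g (vec x) ≈ ε → weight (λ i → g (σ φ i)) (vec x) ≈ ε
  weight∘σ≈ε φ x Wx≈ε = signed≈ε⇒≈ε (sign φ) (begin
    signed (sign φ) (weight (λ i → g (σ φ i)) (vec x)) ≈⟨ weight-SignedPermutation (signedPermutation φ) g x ⟨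
    weight g (vec (Stab.to φ x))
      ≈⟨ InL⇒weight≈ε (Stab.to φ x) (Stab.maps-into φ x (weight≈ε⇒InL x Wx≈ε)) ⟩
    ε                                                    ∎)

  -- X = (e_{y∙z} - e_y) + (e_0 - e_z) lies in L_G, and the weight of X relabelled by σ φ is
  -- linear φ (y ∙ z) - linear φ y - linear φ z.
  linear-homo : ∀ φ y z → linear φ (y ∙ z) ≈ linear φ y ∙ linear φ z
  linear-homo φ y z = [a-b]∙[h-c]≈ε⇒a-h≈[b-h]∙[c-h] (P i) (P k) (P l) (translation φ) (begin
    (P i - P k) ∙ (P zero - P l)  ≈⟨ weight-X P ⟨
    weight P (vec X)              ≈⟨ weight∘σ≈ε φ X X∈L ⟩
    ε                             ∎)
    where
    i k l : Fin N
    i = index (y ∙ z)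
    k = index y
    l = index z
    P : Fin N → Carrier
    P j = g (σ φ j)
    X : A N
    X = rootA i k +A rootA zero l
    weight-X : ∀ c → weight c (vec X) ≈ (c i - c k) ∙ (c zero - c l)
    weight-X c = trans (weight-+ c (root i k) (root zero l)) (∙-cong (weight-root c i k) (weight-root c zero l))
    X∈L : weight g (vec X) ≈ ε
    X∈L = begin
      weight g (vec X)                   ≈⟨ weight-X g ⟩
      (g i - g k) ∙ (g zero - g l)
        ≈⟨ ∙-cong (∙-cong (g-index (y ∙ z)) (⁻¹-cong (g-index y))) (∙-cong g₀≈ε (⁻¹-cong (g-index z))) ⟩
      ((y ∙ z) - y) ∙ (ε - z)            ≈⟨ ∙-cong (xyx⁻¹≈y y z) (identityˡ (z ⁻¹)) ⟩
      z - z                              ≈⟨ inverseʳ z ⟩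
      ε                                  ∎

  linear-cong : ∀ φ {y z} → y ≈ z → linear φ y ≈ linear φ z
  linear-cong φ y≈z = ∙-congʳ (reflexive (≡.cong (λ j → g (σ φ j)) (index-cong y≈z)))

  linear-injective : ∀ φ → Injective _≈_ _≈_ (linear φ)
  linear-injective φ {y} {z} αy≈αz = begin
    y                  ≈⟨ g-index y ⟨
    g (index y)        ≡⟨ ≡.cong g (σ-injective φ (g-injective (∙-cancelʳ (translation φ ⁻¹) _ _ αy≈αz))) ⟩
    g (index z)        ≈⟨ g-index z ⟩
    z                  ∎

  linear-surjective : ∀ φ → Surjective _≈_ _≈_ (linear φ)
  linear-surjective φ z = w , λ w′≈w → trans (linear-cong φ w′≈w) αw≈z
    where
    π : Permutation′ N
    π = SignedPermutation.perm (signedPermutation φ)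
    j : Fin N
    j = index (z ∙ translation φ)
    w : Carrier
    w = g (π ⟨$⟩ˡ j)
    αw≈z : linear φ w ≈ z
    αw≈z = begin
      g (σ φ (index w)) - translation φ         ≡⟨ ≡.cong (λ i → g (σ φ i) - translation φ) (index-g (π ⟨$⟩ˡ j)) ⟩
      g (π ⟨$⟩ʳ (π ⟨$⟩ˡ j)) - translation φ     ≡⟨ ≡.cong (λ i → g i - translation φ) (Perm.inverseʳ π) ⟩
      g j - translation φ                       ≈⟨ ∙-congʳ (g-index (z ∙ translation φ)) ⟩
      (z ∙ translation φ) - translation φ       ≈⟨ ∙-congʳ (comm z (translation φ)) ⟩
      (translation φ ∙ z) - translation φ       ≈⟨ xyx⁻¹≈y (translation φ) z ⟩
      z                                         ∎

  linearAut : Stab G g → AutG G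
  linearAut φ = record
    { f         = linear φ
    ; f-cong    = linear-cong φ
    ; f-homo    = linear-homo φ
    ; bijective = linear-injective φ , linear-surjective φ
    }

  open MagmaMorphisms (StabMagma G g) (C2×SD G)
  open RawMagma (StabMagma G g) using () renaming (_≈_ to _≈ˢ_; _∙_ to _∙ˢ_)
  open RawMagma (C2×SD G) using () renaming (_≈_ to _≈ᶜ_; _∙_ to _∙ᶜ_)

  toC2×SD : Stab G g → Bool × SD G
  toC2×SD φ = sign φ , translation φ , linearAut φ

  toC2×SD-cong : ∀ {φ ψ} → φ ≈ˢ ψ → toC2×SD φ ≈ᶜ toC2×SD ψ
  toC2×SD-cong {φ} {ψ} φ≈ψ = proj₁ unique , shift-cong (proj₂ unique) , linearOf-cong (proj₂ unique)
    where
    unique : sign φ ≡ sign ψ × (∀ i → σ φ i ≡ σ ψ i)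
    unique = SignedPermutation-unique φ≈ψ (signedPermutation φ) (signedPermutation ψ)

  toC2×SD-homo : ∀ φ ψ → toC2×SD (φ ∙ˢ ψ) ≈ᶜ toC2×SD φ ∙ᶜ toC2×SD ψ
  toC2×SD-homo φ ψ = proj₁ unique , translation-homo , linear-homo′
    where
    χ : Stab G g
    χ = φ ∙ˢ ψ
    unique : sign χ ≡ (sign φ xor sign ψ) × (∀ i → σ χ i ≡ σ φ (σ ψ i))
    unique = SignedPermutation-unique (λ _ → ≡.refl) (signedPermutation χ)
               (SignedPermutation-∘ (signedPermutation φ) (signedPermutation ψ))
    σχ≗σφ∘σψ : ∀ i → σ χ i ≡ σ φ (σ ψ i)
    σχ≗σφ∘σψ = proj₂ unique
    linear-g : ∀ i → linear φ (g i) ≈ g (σ φ i) - translation φ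
    linear-g i = ∙-congʳ (reflexive (≡.cong (λ j → g (σ φ j)) (index-g i)))
    translation-homo : translation χ ≈ translation φ ∙ linear φ (translation ψ)
    translation-homo = begin
      g (σ χ zero)                                                  ≡⟨ ≡.cong g (σχ≗σφ∘σψ zero) ⟩
      g (σ φ (σ ψ zero))                                            ≈⟨ x∙[y-x]≈y (translation φ) _ ⟨
      translation φ ∙ (g (σ φ (σ ψ zero)) - translation φ)          ≈⟨ ∙-congˡ (linear-g (σ ψ zero)) ⟨
      translation φ ∙ linear φ (translation ψ)                      ∎
    linear-homo′ : ∀ y → linear χ y ≈ linear φ (linear ψ y)
    linear-homo′ y = begin
      linear χ y                                                    ≈⟨ linearOf-cong σχ≗σφ∘σψ y ⟩
      g (σ φ (σ ψ (index y))) - g (σ φ (σ ψ zero))                  ≈⟨ x∙z-y∙z≈x-y _ _ (translation φ ⁻¹) ⟨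
      (g (σ φ (σ ψ (index y))) - translation φ) - (g (σ φ (σ ψ zero)) - translation φ)
        ≈⟨ ∙-cong (linear-g (σ ψ (index y))) (⁻¹-cong (linear-g (σ ψ zero))) ⟨
      linear φ (g (σ ψ (index y))) - linear φ (translation ψ)       ≈⟨ ∙-congˡ (f-⁻¹ (translation ψ)) ⟨
      linear φ (g (σ ψ (index y))) ∙ linear φ (translation ψ ⁻¹)    ≈⟨ linear-homo φ _ _ ⟨
      linear φ (linear ψ y)                                         ∎
      where open Homomorphism (linear-cong φ) (linear-homo φ) using (f-⁻¹)

  toC2×SD-injective : ∀ {φ ψ} → toC2×SD φ ≈ᶜ toC2×SD ψ → φ ≈ˢ ψ
  toC2×SD-injective {φ} {ψ} (sign≡ , translation≈ , linear≈) =
    SignedPermutation-ext (signedPermutation φ) (signedPermutation ψ) sign≡ σ≗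
    where
    σ≗ : ∀ i → σ φ i ≡ σ ψ i
    σ≗ i = ≡.subst (λ j → σ φ j ≡ σ ψ j) (index-g i)
             (g-injective (∙-cancelʳ (translation φ ⁻¹) _ _
               (trans (linear≈ (g i)) (∙-congˡ (⁻¹-cong (sym translation≈))))))

  module Preimage (s : Bool) (h : Carrier) (α : AutG G) where
    open AutG α using (f; f-cong)
    open Homomorphism (AutG.f-cong α) (AutG.f-homo α) using (f-ε)

    τ : Fin N → Fin N
    τ i = index (h ∙ f (g i))

    τ-injective : Injective _≡_ _≡_ τ
    τ-injective {i} {j} τi≡τj = g-injective (proj₁ (AutG.bijective α) (∙-cancelˡ h _ _ (begin
      h ∙ f (g i)     ≈⟨ g-index _ ⟨
      g (τ i)         ≡⟨ ≡.cong g τi≡τj ⟩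
      g (τ j)         ≈⟨ g-index _ ⟩
      h ∙ f (g j)     ∎)))

    τ-perm : Permutation′ N
    τ-perm = injective⇒permutation τ τ-injective

    aut : AutA N
    aut = signedPermuteAut s τ-perm

    open AutA aut using (to; from; to-from)

    weight-to : ∀ x → weight g (vec (to x)) ≈ signed s (f (weight g (vec x)))
    weight-to x = begin
      weight g (vec (to x))
        ≈⟨ weight-SignedPermutation (signedPermute-SignedPermutation s τ-perm) g x ⟩
      signed s (weight (λ i → g (τ i)) (vec x))
        ≈⟨ signed-cong s (weight-affine α h (λ i → g-index (h ∙ f (g i))) (vec x)) ⟩
      signed s (intMul G (sumℤ (vec x)) h ∙ f (weight g (vec x)))
        ≡⟨ ≡.cong (λ k → signed s (intMul G k h ∙ f (weight g (vec x)))) (proj₂ x) ⟩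
      signed s (ε ∙ f (weight g (vec x)))                              ≈⟨ signed-cong s (identityˡ _) ⟩
      signed s (f (weight g (vec x)))                                  ∎

    maps-into : ∀ x → InL G g x → InL G g (to x)
    maps-into x x∈L = weight≈ε⇒InL (to x) (begin
      weight g (vec (to x))                ≈⟨ weight-to x ⟩
      signed s (f (weight g (vec x)))      ≈⟨ ≈ε⇒signed≈ε s (trans (f-cong (InL⇒weight≈ε x x∈L)) f-ε) ⟩
      ε                                    ∎)

    maps-onto : ∀ x → InL G g x → Σ (A N) (λ y → InL G g y × vec (to y) ≡ vec x)
    maps-onto x x∈L = from x , weight≈ε⇒InL (from x) from-x∈L , to-from x
      where
      from-x∈L : weight g (vec (from x)) ≈ ε
      from-x∈L = proj₁ (AutG.bijective α) (trans (signed≈ε⇒≈ε s (begin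
        signed s (f (weight g (vec (from x))))   ≈⟨ weight-to (from x) ⟨
        weight g (vec (to (from x)))             ≡⟨ ≡.cong (weight g) (to-from x) ⟩
        weight g (vec x)                         ≈⟨ InL⇒weight≈ε x x∈L ⟩
        ε                                        ∎)) (sym f-ε))

    preimage : Stab G g
    preimage = record { aut = aut ; maps-into = maps-into ; maps-onto = maps-onto }

    toC2×SD-preimage : ∀ {φ} → φ ≈ˢ preimage → toC2×SD φ ≈ᶜ (s , h , α)
    toC2×SD-preimage {φ} φ≈preimage = proj₁ unique , translation≈h , linear≈f
      where
      unique : sign φ ≡ s × (∀ i → σ φ i ≡ τ i)
      unique = SignedPermutation-unique φ≈preimage (signedPermutation φ) (signedPermute-SignedPermutation s τ-perm)
      g∘σ : ∀ i → g (σ φ i) ≈ h ∙ f (g i)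
      g∘σ i = trans (reflexive (≡.cong g (proj₂ unique i))) (g-index (h ∙ f (g i)))
      translation≈h : translation φ ≈ h
      translation≈h = begin
        g (σ φ zero)     ≈⟨ g∘σ zero ⟩
        h ∙ f (g zero)   ≈⟨ ∙-congˡ (trans (f-cong g₀≈ε) f-ε) ⟩
        h ∙ ε            ≈⟨ identityʳ h ⟩
        h                ∎
      linear≈f : ∀ y → linear φ y ≈ f y
      linear≈f y = begin
        g (σ φ (index y)) - translation φ    ≈⟨ ∙-cong (g∘σ (index y)) (⁻¹-cong translation≈h) ⟩
        (h ∙ f (g (index y))) - h            ≈⟨ xyx⁻¹≈y h _ ⟩
        f (g (index y))                      ≈⟨ f-cong (g-index y) ⟩
        f y                                  ∎

  isMagmaIsomorphism : IsMagmaIsomorphism toC2×SD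
  isMagmaIsomorphism = record
    { isMagmaMonomorphism = record
      { isMagmaHomomorphism = record
        { isRelHomomorphism = record { cong = λ {φ} {ψ} → toC2×SD-cong {φ} {ψ} }
        ; homo              = toC2×SD-homo
        }
      ; injective = λ {φ} {ψ} → toC2×SD-injective {φ} {ψ}
      }
    ; surjective = λ { (s , h , α) → Preimage.preimage s h α , λ {φ} → Preimage.toC2×SD-preimage s h α {φ} }
    }

proposition3p1 : ∀ {c ℓ} (G : AbelianGroup c ℓ) (m : ℕ) → 3 ≤ suc m
                   → (g : Fin (suc m) → AbelianGroup.Carrier G)
                   → Bijective _≡_ (AbelianGroup._≈_ G) g
                   → AbelianGroup._≈_ G (g zero) (AbelianGroup.ε G)
                   → ∃ λ F → MagmaMorphisms.IsMagmaIsomorphism (StabMagma G g) (C2×SD G) F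
proposition3p1 G 0             (s≤s ())
proposition3p1 G 1             (s≤s (s≤s ()))
proposition3p1 G (suc (suc p)) _ g g-bij g₀≈ε = toC2×SD , isMagmaIsomorphism
  where open Stabiliser G g g-bij g₀≈ε
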